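{- Let $s$ be a constellation of length $j_1$ and sum $|s|$. Let $p_0$ be a prime, and let $p_1<p_2<\dots$ be the consecutive primes after $p_0$, with $|s|<2p_1$. Let $J\ge j_1$ be such that $\mathcal{G}(p_0\#)$ contains no driving term for $s$ of length greater than $J$, and for a prime $p\ge p_0$ let $n_s(p\#)=(n_{s,j_1}(p\#),n_{s,j_1+1}(p\#),\dots,n_{s,J}(p\#))^T$. Then for every $k\ge1$, $$n_s(p_k\#)=M_{j_1:J}(p_k)\,n_s(p_{k-1}\#),$$ where $M_{j_1:J}(p)$ is the $(J-j_1+1)\times(J-j_1+1)$ upper bidiagonal matrix whose diagonal entries are $p-j_1-1,\ p-j_1-2,\dots,\ p-J-1$ and whose superdiagonal entries are $1,2,\dots,J-j_1$. Moreover $M_{j_1:J}(p)=R\,\Lambda_{j_1:J}(p)\,L$, where, indexing rows and columns by $a,b\in\{1,\dots,J-j_1+1\}$, $L_{ab}=\binom{b-1}{a-1}$ and $R_{ab}=(-1)^{a+b}\binom{b-1}{a-1}$ for $a\le b$ and $L_{ab}=R_{ab}=0$ for $a>b$ (so $LR=I$), and $\Lambda_{j_1:J}(p)=\mathrm{diag}(p-j_1-1,p-j_1-2,\dots,p-J-1)$.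
   Context: For a prime $p$, $p\#$ denotes the product of all primes $\le p$. For a positive integer $N$, let $1=u_0<\dots<u_{\varphi(N)}=N+1$ be the integers in $[1,N+1]$ coprime to $N$, and $\mathcal{G}(N)=(g_1,\dots,g_{\varphi(N)})$, $g_i=u_i-u_{i-1}$, indices cyclic mod $\varphi(N)$. A constellation is a sequence $s=(s_1,\dots,s_{j_1})$ of positive integers, of length $j_1$ and sum $|s|=s_1+\dots+s_{j_1}$. For $j\ge j_1$, a driving term of length $j$ for $s$ in $\mathcal{G}(N)$ is a position $i\in\{1,\dots,\varphi(N)\}$ such that the $j$ cyclically consecutive gaps $g_i,\dots,g_{i+j-1}$ can be split into $j_1$ consecutive nonempty blocks with sums $s_1,\dots,s_{j_1}$ in order; $n_{s,j}(N)$ is the number of such positions. -}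

module Defs where

open import Data.Bool using (Bool; true; false; _∧_; if_then_else_)
open import Data.Nat using (ℕ; zero; suc; _+_; _*_; _∸_; _≤ᵇ_; _≡ᵇ_; _!; _%_)
open import Data.Nat.Combinatorics using (_C_)
open import Data.Nat.Coprimality using (coprime?)
open import Data.Nat.Primality using (prime?)
open import Data.Nat.ListAction using (sum)
open import Data.Bool.ListAction using (any)
open import Data.List using (List; []; _∷_; length; take; drop; null; filter; filterᵇ; applyUpTo; upTo; map)
open import Data.Fin using (Fin; toℕ)
import Data.Fin
open import Data.Integer as ℤ using (ℤ; +_)
open import Relation.Nullary.Decidable using (does)

primorial : ℕ → ℕ
primorial zero    = 1
primorial (suc n) = if does (prime? (suc n)) then suc n * primorial n else primorial n

-- The next prime after p: the least prime in (p, p + p!]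
-- (by Euclid such a prime always exists, since p!+1 has a prime factor > p).

firstOr : ℕ → List ℕ → ℕ
firstOr d []      = d
firstOr d (x ∷ _) = x

nextPrime : ℕ → ℕ
nextPrime p = firstOr 0 (filter prime? (applyUpTo (λ i → suc p + i) (p !)))

primeSeq : ℕ → ℕ → ℕ
primeSeq p₀ zero    = p₀
primeSeq p₀ (suc k) = nextPrime (primeSeq p₀ k)

coprimeList : ℕ → List ℕ
coprimeList N = filter (λ u → coprime? u N) (applyUpTo suc (suc N))

diffs : List ℕ → List ℕ
diffs (x ∷ y ∷ r) = (y ∸ x) ∷ diffs (y ∷ r)
diffs _           = []

-- 𝒢(N) = (g_1, …, g_φ(N)), stored 0-indexed (list entry i is g_{i+1})
gaps : ℕ → List ℕ
gaps N = diffs (coprimeList N)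

nth : List ℕ → ℕ → ℕ
nth []       _       = 0
nth (x ∷ xs) zero    = x
nth (x ∷ xs) (suc i) = nth xs i

cyc : List ℕ → ℕ → ℕ
cyc []          i = 0
cyc g@(_ ∷ _)   i = nth g (i % length g)

window : List ℕ → ℕ → ℕ → List ℕ
window g i j = map (λ t → cyc g (i + t)) (upTo j)

splits : List ℕ → List ℕ → Bool
splits []       ws = null ws
splits (x ∷ ss) ws =
  any (λ k → (sum (take k ws) ≡ᵇ x) ∧ splits ss (drop k ws))
      (applyUpTo suc (length ws))

-- n_{s,j}(N): number of positions i ∈ {1,…,φ(N)} that are driving terms
-- of length j for s in 𝒢(N).
drivingCount : List ℕ → ℕ → ℕ → ℕ
drivingCount s j N =
  length (filterᵇ (λ i → splits s (window (gaps N) i j)) (upTo (length (gaps N))))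

-- Matrices over ℤ, indexed by Fin m (0-indexed: row a here is row a+1 of the paper).

Matrix : ℕ → Set
Matrix m = Fin m → Fin m → ℤ

sumFin : ∀ {m} → (Fin m → ℤ) → ℤ
sumFin {zero}  f = + 0
sumFin {suc m} f = f Data.Fin.zero ℤ.+ sumFin (λ i → f (Data.Fin.suc i))

_⊗_ : ∀ {m} → Matrix m → Matrix m → Matrix m
(A ⊗ B) a b = sumFin (λ c → A a c ℤ.* B c b)

_·_ : ∀ {m} → Matrix m → (Fin m → ℤ) → (Fin m → ℤ)
(A · v) a = sumFin (λ c → A a c ℤ.* v c)

identity : ∀ {m} → Matrix m
identity a b = if toℕ a ≡ᵇ toℕ b then + 1 else + 0

diagEntry : ℕ → ℕ → ℕ → ℤ
diagEntry p j₁ a = + p ℤ.- + j₁ ℤ.- + 1 ℤ.- + a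

Mmat : (j₁ J p : ℕ) → Matrix (suc (J ∸ j₁))
Mmat j₁ J p a b =
  if toℕ a ≡ᵇ toℕ b then diagEntry p j₁ (toℕ a)
  else if suc (toℕ a) ≡ᵇ toℕ b then + toℕ b
  else + 0

Λmat : (j₁ J p : ℕ) → Matrix (suc (J ∸ j₁))
Λmat j₁ J p a b = if toℕ a ≡ᵇ toℕ b then diagEntry p j₁ (toℕ a) else + 0

Lmat : ∀ {m} → Matrix m
Lmat a b = if toℕ a ≤ᵇ toℕ b then + (toℕ b C toℕ a) else + 0

signℤ : ℕ → ℤ
signℤ n = if (n % 2) ≡ᵇ 0 then + 1 else ℤ.- + 1

Rmat : ∀ {m} → Matrix m
Rmat a b = if toℕ a ≤ᵇ toℕ b then signℤ (toℕ a + toℕ b) ℤ.* + (toℕ b C toℕ a) else + 0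

nvec : (s : List ℕ) (J N : ℕ) → Fin (suc (J ∸ length s)) → ℤ
nvec s J N t = + drivingCount s (length s + toℕ t) N

-- Write N = p_{k-1}# and p = p_k, so that p_k# = p N. A unit u mod p N lies over the unit u mod N
-- and is not divisible by p, so the units mod p N over a unit w mod N are the w + m N, m < p, with
-- those divisible by p removed. In the window [w + m N, w + m N + |s|] the shift m removes at most one
-- unit (two removed units would be a nonzero multiple of p below 2 p, hence exactly p, apart, an odd
-- distance between odd numbers), and by the Chinese remainder theorem each slot of the window is
-- removed by exactly one m. Counting the shifts that keep w and all w + σ (σ a partial sum of s)
-- and leave exactly j + 1 units in the window gives
--   n_{s,j}(p N) + (j + 1) n_{s,j}(N) = p n_{s,j}(N) + (j + 1 - j₁) n_{s,j+1}(N),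
-- which is row j of M(p) n_s(N); the same identity shows that counts beyond J stay zero.
-- M = R Λ L and L R = I are binomial identities: c C(c,a) = a C(c,a) + (a+1) C(c,a+1), and binomial
-- inversion.

module Submission where

open import Data.Bool using (Bool; true; false; _∧_; _∨_; not; if_then_else_)
open import Data.Bool.Properties using (∧-conicalˡ; ∧-conicalʳ; ∧-comm; ∧-zeroʳ)
open import Data.Bool.ListAction using (and; any; all)
open import Data.List using (List; []; _∷_; length; take; drop; filter; filterᵇ; applyUpTo; upTo; map)
open import Data.List.Properties using (length-applyUpTo; map-upTo; map-∘; map-cong; length-map)
open import Data.List.Relation.Unary.All using (All; []; _∷_)
open import Data.Product using (Σ; _×_; _,_; proj₁; proj₂)
open import Data.Sum using (_⊎_; inj₁; inj₂)
open import Data.Empty using (⊥; ⊥-elim)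
open import Relation.Nullary using (¬_; Dec; yes; no; does)
open import Relation.Nullary.Decidable using (dec-true; dec-false)
open import Relation.Binary.Definitions using (tri<; tri≈; tri>)
open import Relation.Binary.PropositionalEquality
open import Defs
open import Data.Nat using (ℕ; zero; suc; _≡ᵇ_)
open import Data.Nat.Properties using (suc-injective)

bool-ext : ∀ {a b : Bool} → (a ≡ true → b ≡ true) → (b ≡ true → a ≡ true) → a ≡ b
bool-ext {false} {false} f g = refl
bool-ext {false} {true}  f g = g refl
bool-ext {true}  {false} f g = sym (f refl)
bool-ext {true}  {true}  f g = refl

≢true⇒≡false : ∀ {b} → b ≢ true → b ≡ false
≢true⇒≡false {false} _ = refl
≢true⇒≡false {true}  h = ⊥-elim (h refl)

∧-intro : ∀ {a b} → a ≡ true → b ≡ true → (a ∧ b) ≡ true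
∧-intro refl refl = refl

≡ᵇ-true⇒≡ : ∀ m n → (m ≡ᵇ n) ≡ true → m ≡ n
≡ᵇ-true⇒≡ zero    zero    e = refl
≡ᵇ-true⇒≡ (suc m) (suc n) e = cong suc (≡ᵇ-true⇒≡ m n e)

≡⇒≡ᵇ-true : ∀ m n → m ≡ n → (m ≡ᵇ n) ≡ true
≡⇒≡ᵇ-true zero    zero    e = refl
≡⇒≡ᵇ-true (suc m) (suc n) e = ≡⇒≡ᵇ-true m n (suc-injective e)

≢⇒≡ᵇ-false : ∀ m n → m ≢ n → (m ≡ᵇ n) ≡ false
≢⇒≡ᵇ-false m n m≢n = ≢true⇒≡false (λ e → m≢n (≡ᵇ-true⇒≡ m n e))

does-true⇒ : ∀ {P : Set} (P? : Dec P) → does P? ≡ true → P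
does-true⇒ (yes p) _ = p

does-cong : ∀ {P Q : Set} (P? : Dec P) (Q? : Dec Q) → (P → Q) → (Q → P) → does P? ≡ does Q?
does-cong (yes p) (yes q) f g = refl
does-cong (yes p) (no ¬q) f g = ⊥-elim (¬q (f p))
does-cong (no ¬p) (yes q) f g = ⊥-elim (¬p (g q))
does-cong (no ¬p) (no ¬q) f g = refl

module FiniteSums where

  open import Data.Nat
  open import Data.Nat.Properties
  open import Data.Nat.Tactic.RingSolver using (solve-∀)

  sumBelow : (ℕ → ℕ) → ℕ → ℕ
  sumBelow f zero    = 0
  sumBelow f (suc n) = f 0 + sumBelow (λ i → f (suc i)) n

  fromBool : Bool → ℕ
  fromBool true  = 1
  fromBool false = 0

  count : (ℕ → Bool) → ℕ → ℕ
  count P n = sumBelow (λ i → fromBool (P i)) n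

  sumBelow-cong : ∀ n {f g} → (∀ i → i < n → f i ≡ g i) → sumBelow f n ≡ sumBelow g n
  sumBelow-cong zero    h = refl
  sumBelow-cong (suc n) h = cong₂ _+_ (h 0 z<s) (sumBelow-cong n (λ i i<n → h (suc i) (s<s i<n)))

  sumBelow-+ : ∀ m n f → sumBelow f (m + n) ≡ sumBelow f m + sumBelow (λ i → f (m + i)) n
  sumBelow-+ zero    n f = refl
  sumBelow-+ (suc m) n f =
    trans (cong (f 0 +_) (sumBelow-+ m n (λ i → f (suc i)))) (sym (+-assoc (f 0) _ _))

  sumBelow-suc : ∀ n f → sumBelow f (suc n) ≡ sumBelow f n + f n
  sumBelow-suc n f = begin
    sumBelow f (suc n)                             ≡⟨ cong (sumBelow f) (+-comm 1 n) ⟩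
    sumBelow f (n + 1)                             ≡⟨ sumBelow-+ n 1 f ⟩
    sumBelow f n + (f (n + 0) + 0)                 ≡⟨ cong (λ z → sumBelow f n + (f z + 0)) (+-identityʳ n) ⟩
    sumBelow f n + (f n + 0)                       ≡⟨ cong (sumBelow f n +_) (+-identityʳ (f n)) ⟩
    sumBelow f n + f n                             ∎
    where open ≡-Reasoning

  sumBelow-distrib-+ : ∀ n f g → sumBelow (λ i → f i + g i) n ≡ sumBelow f n + sumBelow g n
  sumBelow-distrib-+ zero    f g = refl
  sumBelow-distrib-+ (suc n) f g =
    trans (cong (f 0 + g 0 +_) (sumBelow-distrib-+ n (λ i → f (suc i)) (λ i → g (suc i))))
          (interchange (f 0) (g 0) _ _)
    where
    interchange : ∀ a b c d → (a + b) + (c + d) ≡ (a + c) + (b + d)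
    interchange = solve-∀

  sumBelow-*ˡ : ∀ n k f → sumBelow (λ i → k * f i) n ≡ k * sumBelow f n
  sumBelow-*ˡ zero    k f = sym (*-zeroʳ k)
  sumBelow-*ˡ (suc n) k f =
    trans (cong (k * f 0 +_) (sumBelow-*ˡ n k (λ i → f (suc i)))) (sym (*-distribˡ-+ k (f 0) _))

  sumBelow-const : ∀ n k → sumBelow (λ _ → k) n ≡ n * k
  sumBelow-const zero    k = refl
  sumBelow-const (suc n) k = cong (k +_) (sumBelow-const n k)

  sumBelow-zero : ∀ n f → (∀ i → i < n → f i ≡ 0) → sumBelow f n ≡ 0
  sumBelow-zero n f h = trans (sumBelow-cong n h) (trans (sumBelow-const n 0) (*-zeroʳ n))

  sumBelow≡0⇒ : ∀ n f → sumBelow f n ≡ 0 → ∀ i → i < n → f i ≡ 0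
  sumBelow≡0⇒ (suc n) f e zero    _         = m+n≡0⇒m≡0 (f 0) e
  sumBelow≡0⇒ (suc n) f e (suc i) (s<s i<n) =
    sumBelow≡0⇒ n (λ i → f (suc i)) (m+n≡0⇒n≡0 (f 0) e) i i<n

  sumBelow-swap : ∀ n m (h : ℕ → ℕ → ℕ) →
    sumBelow (λ i → sumBelow (λ j → h i j) m) n ≡ sumBelow (λ j → sumBelow (λ i → h i j) n) m
  sumBelow-swap zero    m h = sym (sumBelow-zero m (λ _ → 0) (λ _ _ → refl))
  sumBelow-swap (suc n) m h =
    trans (cong (sumBelow (λ j → h 0 j) m +_) (sumBelow-swap n m (λ i j → h (suc i) j)))
          (sym (sumBelow-distrib-+ m (λ j → h 0 j) (λ j → sumBelow (λ i → h (suc i) j) n)))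

  sumBelow-mono : ∀ n {f g} → (∀ i → i < n → f i ≤ g i) → sumBelow f n ≤ sumBelow g n
  sumBelow-mono zero    h = z≤n
  sumBelow-mono (suc n) h = +-mono-≤ (h 0 z<s) (sumBelow-mono n (λ i i<n → h (suc i) (s<s i<n)))

  sumBelow-∸ : ∀ n f g → (∀ i → i < n → g i ≤ f i) →
    sumBelow (λ i → f i ∸ g i) n + sumBelow g n ≡ sumBelow f n
  sumBelow-∸ n f g h = trans (sym (sumBelow-distrib-+ n _ _)) (sumBelow-cong n (λ i i<n → m∸n+n≡m (h i i<n)))

  sumBelow-blocks : ∀ p N f → sumBelow f (p * N) ≡ sumBelow (λ m → sumBelow (λ v → f (m * N + v)) N) p
  sumBelow-blocks zero    N f = refl
  sumBelow-blocks (suc p) N f = trans (sumBelow-+ N (p * N) f) (cong (sumBelow f N +_)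
    (trans (sumBelow-blocks p N (λ i → f (N + i)))
           (sumBelow-cong p (λ m _ → sumBelow-cong N (λ v _ → cong f (sym (+-assoc N (m * N) v)))))))

  sumBelow-firstNonzero : ∀ d e F → e < d → (∀ t → t < e → F t ≡ 0) →
    sumBelow F d ≡ F e + sumBelow (λ t → F (suc e + t)) (d ∸ suc e)
  sumBelow-firstNonzero d e F e<d h = begin
    sumBelow F d                                   ≡⟨ cong (sumBelow F) (sym (m+[n∸m]≡n e<d)) ⟩
    sumBelow F (suc e + (d ∸ suc e))               ≡⟨ sumBelow-+ (suc e) (d ∸ suc e) F ⟩
    sumBelow F (suc e) + rest                      ≡⟨ cong (_+ rest) (sumBelow-suc e F) ⟩
    sumBelow F e + F e + rest                      ≡⟨ cong (λ z → z + F e + rest) (sumBelow-zero e F h) ⟩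
    F e + rest                                     ∎
    where
    open ≡-Reasoning
    rest : ℕ
    rest = sumBelow (λ t → F (suc e + t)) (d ∸ suc e)

  sumBelow-rotate : ∀ n f → f 0 ≡ f n → sumBelow (λ t → f (suc t)) n ≡ sumBelow f n
  sumBelow-rotate n f e =
    +-cancelˡ-≡ (f 0) _ _ (trans (sumBelow-suc n f) (trans (cong (sumBelow f n +_) (sym e)) (+-comm _ (f 0))))

  count-none : ∀ n P → (∀ i → i < n → P i ≡ false) → count P n ≡ 0
  count-none n P h = sumBelow-zero n _ (λ i i<n → cong fromBool (h i i<n))

  count-pos : ∀ n P i → i < n → P i ≡ true → 1 ≤ count P n
  count-pos n P i i<n Pi with count P n in eq
  ... | suc _ = s≤s z≤n
  ... | zero  = ⊥-elim (1≢0 (sumBelow≡0⇒ n _ eq i i<n))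
    where
    1≢0 : fromBool (P i) ≢ 0
    1≢0 rewrite Pi = λ ()

  fromBool-∧ : ∀ a b → fromBool (a ∧ b) ≡ fromBool a * fromBool b
  fromBool-∧ true  true  = refl
  fromBool-∧ true  false = refl
  fromBool-∧ false b     = refl

  count-split : ∀ n (P Q : ℕ → Bool) → count P n ≡ count (λ t → P t ∧ not (Q t)) n + count (λ t → P t ∧ Q t) n
  count-split n P Q = trans (sumBelow-cong n (λ t _ → split (P t) (Q t))) (sumBelow-distrib-+ n _ _)
    where
    split : ∀ a b → fromBool a ≡ fromBool (a ∧ not b) + fromBool (a ∧ b)
    split true  true  = refl
    split true  false = refl
    split false b     = refl

  count-∨ : ∀ n (P Q : ℕ → Bool) → (∀ t → t < n → (P t ∧ Q t) ≡ false) →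
    count (λ t → P t ∨ Q t) n ≡ count P n + count Q n
  count-∨ n P Q h = trans (sumBelow-cong n (λ t t<n → disjoint (P t) (Q t) (h t t<n))) (sumBelow-distrib-+ n _ _)
    where
    disjoint : ∀ a b → (a ∧ b) ≡ false → fromBool (a ∨ b) ≡ fromBool a + fromBool b
    disjoint true  false _ = refl
    disjoint false b     _ = refl

  count≤1 : ∀ n P → (∀ i j → i < n → j < n → P i ≡ true → P j ≡ true → i ≡ j) → count P n ≤ 1
  count≤1 zero    P h = z≤n
  count≤1 (suc n) P h with P 0 in P0
  ... | true  = ≤-reflexive (cong suc (count-none n (λ i → P (suc i))
                  (λ i i<n → ≢true⇒≡false (λ Pi → 0≢1+n (h 0 (suc i) z<s (s<s i<n) P0 Pi)))))
  ... | false = count≤1 n (λ i → P (suc i))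
                  (λ i j i<n j<n Pi Pj → suc-injective (h (suc i) (suc j) (s<s i<n) (s<s j<n) Pi Pj))

  count≡1 : ∀ n P i → i < n → P i ≡ true → (∀ i j → i < n → j < n → P i ≡ true → P j ≡ true → i ≡ j) →
    count P n ≡ 1
  count≡1 n P i i<n Pi h = ≤-antisym (count≤1 n P h) (count-pos n P i i<n Pi)

  count-≡ᵇ : ∀ R x → x < R → count (λ t → t ≡ᵇ x) R ≡ 1
  count-≡ᵇ R x x<R = count≡1 R _ x x<R (≡⇒≡ᵇ-true x x refl)
    (λ i j _ _ ei ej → trans (≡ᵇ-true⇒≡ i x ei) (sym (≡ᵇ-true⇒≡ j x ej)))

module ListFacts where

  open import Data.Nat
  open import Data.Nat.Properties
  open import Data.Nat.DivMod using (_%_; m%n<n)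
  open import Data.Nat.ListAction using (sum)
  open FiniteSums

  any-applyUpTo⁻ : ∀ (P : ℕ → Bool) g n → any P (applyUpTo g n) ≡ true → Σ ℕ λ i → i < n × P (g i) ≡ true
  any-applyUpTo⁻ P g (suc n) e with P (g 0) in P0
  ... | true  = 0 , z<s , P0
  ... | false with any-applyUpTo⁻ P (λ i → g (suc i)) n e
  ... | i , i<n , h = suc i , s<s i<n , h

  any-applyUpTo⁺ : ∀ (P : ℕ → Bool) g n i → i < n → P (g i) ≡ true → any P (applyUpTo g n) ≡ true
  any-applyUpTo⁺ P g (suc n) zero    _         h rewrite h = refl
  any-applyUpTo⁺ P g (suc n) (suc i) (s<s i<n) h with P (g 0)
  ... | true  = refl
  ... | false = any-applyUpTo⁺ P (λ i → g (suc i)) n i i<n h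

  all-map : ∀ (P : ℕ → Bool) (g : ℕ → ℕ) L → all P (map g L) ≡ all (λ x → P (g x)) L
  all-map P g L = cong and (sym (map-∘ L))

  all-cong : ∀ {P Q : ℕ → Bool} L → (∀ x → P x ≡ Q x) → all P L ≡ all Q L
  all-cong L h = cong and (map-cong h L)

  applyUpTo-cong : ∀ {A : Set} {f g : ℕ → A} n → (∀ i → i < n → f i ≡ g i) → applyUpTo f n ≡ applyUpTo g n
  applyUpTo-cong zero    h = refl
  applyUpTo-cong (suc n) h = cong₂ _∷_ (h 0 z<s) (applyUpTo-cong n (λ i i<n → h (suc i) (s<s i<n)))

  take-applyUpTo : ∀ {A : Set} (f : ℕ → A) k n → k ≤ n → take k (applyUpTo f n) ≡ applyUpTo f k
  take-applyUpTo f zero    n       _         = refl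
  take-applyUpTo f (suc k) (suc n) (s≤s k≤n) = cong (f 0 ∷_) (take-applyUpTo (λ i → f (suc i)) k n k≤n)

  drop-applyUpTo : ∀ {A : Set} (f : ℕ → A) k n → k ≤ n →
    drop k (applyUpTo f n) ≡ applyUpTo (λ t → f (k + t)) (n ∸ k)
  drop-applyUpTo f zero    n       _         = refl
  drop-applyUpTo f (suc k) (suc n) (s≤s k≤n) = drop-applyUpTo (λ i → f (suc i)) k n k≤n

  sum-applyUpTo : ∀ f n → sum (applyUpTo f n) ≡ sumBelow f n
  sum-applyUpTo f zero    = refl
  sum-applyUpTo f (suc n) = cong (f 0 +_) (sum-applyUpTo (λ i → f (suc i)) n)

  length-filterᵇ-applyUpTo : ∀ (P : ℕ → Bool) g n → length (filterᵇ P (applyUpTo g n)) ≡ count (λ i → P (g i)) n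
  length-filterᵇ-applyUpTo P g zero    = refl
  length-filterᵇ-applyUpTo P g (suc n) with P (g 0)
  ... | true  = cong suc (length-filterᵇ-applyUpTo P (λ i → g (suc i)) n)
  ... | false = length-filterᵇ-applyUpTo P (λ i → g (suc i)) n

  filter≡filterᵇ : ∀ {P : ℕ → Set} (P? : ∀ u → Dec (P u)) L → filter P? L ≡ filterᵇ (λ u → does (P? u)) L
  filter≡filterᵇ P? []      = refl
  filter≡filterᵇ P? (x ∷ L) with P? x
  ... | yes _ = cong (x ∷_) (filter≡filterᵇ P? L)
  ... | no  _ = filter≡filterᵇ P? L

  diffs-applyUpTo : ∀ (f : ℕ → ℕ) n → diffs (applyUpTo f (suc n)) ≡ applyUpTo (λ i → f (suc i) ∸ f i) n
  diffs-applyUpTo f zero    = refl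
  diffs-applyUpTo f (suc n) = cong (f 1 ∸ f 0 ∷_) (diffs-applyUpTo (λ i → f (suc i)) n)

  nth-applyUpTo : ∀ (f : ℕ → ℕ) n i → i < n → nth (applyUpTo f n) i ≡ f i
  nth-applyUpTo f (suc n) zero    _         = refl
  nth-applyUpTo f (suc n) (suc i) (s<s i<n) = nth-applyUpTo (λ i → f (suc i)) n i i<n

  cyc-applyUpTo : ∀ (f : ℕ → ℕ) n .{{_ : NonZero n}} m → cyc (applyUpTo f n) m ≡ f (m % n)
  cyc-applyUpTo f (suc n) m =
    trans (cong (λ z → nth (applyUpTo f (suc n)) (m % suc z)) (length-applyUpTo (λ i → f (suc i)) n))
          (nth-applyUpTo f (suc n) (m % suc n) (m%n<n m (suc n)))

  ∸-telescope : ∀ a b c → a ≤ b → b ≤ c → (b ∸ a) + (c ∸ b) ≡ c ∸ a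
  ∸-telescope a b c a≤b b≤c =
    trans (+-comm (b ∸ a) (c ∸ b)) (trans (sym (+-∸-assoc (c ∸ b) a≤b)) (cong (_∸ a) (m∸n+n≡m b≤c)))

module GapCycle where

  open import Data.Nat
  open import Data.Nat.Properties
  open import Data.Nat.DivMod using (_%_; _/_; m%n<n; m≡m%n+[m/n]*n)
  open import Data.Nat.ListAction using (sum)
  open FiniteSums
  open ListFacts

  partialSums : List ℕ → List ℕ
  partialSums []       = []
  partialSums (x ∷ ss) = x ∷ map (x +_) (partialSums ss)

  -- For a set c of residues, a driving term of length j for s at a member w of c means:
  -- w + σ ∈ c for every partial sum σ of s, and (w, w + |s|] contains exactly j members of c.
  module _ (c : ℕ → Bool) where

    countAfter : ℕ → ℕ → ℕ
    countAfter x d = count (λ t → c (x + suc t)) d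

    drivesAt : List ℕ → ℕ → ℕ → Bool
    drivesAt s w j = (countAfter w (sum s) ≡ᵇ j) ∧ all (λ σ → c (w + σ)) (partialSums s)

    periodCount : ℕ → List ℕ → ℕ → ℕ
    periodCount N s j = count (λ t → c t ∧ drivesAt s t j) N

  module Periodic (c : ℕ → Bool) (N : ℕ) (periodic : ∀ x → c (x + N) ≡ c x) where

    periodic* : ∀ k x → c (x + k * N) ≡ c x
    periodic* zero    x = cong c (+-identityʳ x)
    periodic* (suc k) x = trans (cong c (shift x)) (trans (periodic (x + k * N)) (periodic* k x))
      where
      shift : ∀ x → x + (N + k * N) ≡ x + k * N + N
      shift x = trans (cong (x +_) (+-comm N (k * N))) (sym (+-assoc x (k * N) N))

    nextWithin : ℕ → ℕ → ℕ
    nextWithin zero    x = suc x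
    nextWithin (suc k) x = if c (suc x) then suc x else nextWithin k (suc x)

    <nextWithin : ∀ k x → x < nextWithin k x
    <nextWithin zero    x = n<1+n x
    <nextWithin (suc k) x with c (suc x)
    ... | true  = n<1+n x
    ... | false = <-trans (n<1+n x) (<nextWithin k (suc x))

    nextWithin-skips : ∀ k x y → x < y → y < nextWithin k x → c y ≡ false
    nextWithin-skips zero    x y x<y y<n = ⊥-elim (<⇒≱ y<n x<y)
    nextWithin-skips (suc k) x y x<y y<n with c (suc x) in cx
    ... | true  = ⊥-elim (<⇒≱ y<n x<y)
    ... | false with m≤n⇒m<n∨m≡n x<y
    ... | inj₂ refl = cx
    ... | inj₁ sx<y = nextWithin-skips k (suc x) y sx<y y<n

    nextWithin-hits : ∀ k x d → d < k → c (x + suc d) ≡ true → c (nextWithin k x) ≡ true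
    nextWithin-hits (suc k) x d d<k h with c (suc x) in cx
    ... | true = cx
    nextWithin-hits (suc k) x zero    d<k       h | false
      with () ← trans (sym cx) (trans (cong c (+-comm 1 x)) h)
    nextWithin-hits (suc k) x (suc d) (s<s d<k) h | false =
      nextWithin-hits k (suc x) d d<k (trans (cong c (sym (+-suc x (suc d)))) h)

    nextWithin-periodic : ∀ k x → nextWithin k (x + N) ≡ nextWithin k x + N
    nextWithin-periodic zero    x = refl
    nextWithin-periodic (suc k) x rewrite periodic (suc x) with c (suc x)
    ... | true  = refl
    ... | false = nextWithin-periodic k (suc x)

    -- A period always contains a member, so searching N + 1 steps ahead suffices.
    next : ℕ → ℕ
    next x = nextWithin (suc N) x

    <next : ∀ x → x < next x
    <next = <nextWithin (suc N)

    next-skips : ∀ x y → x < y → y < next x → c y ≡ false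
    next-skips = nextWithin-skips (suc N)

    next-periodic : ∀ x → next (x + N) ≡ next x + N
    next-periodic = nextWithin-periodic (suc N)

    gap : ℕ → ℕ
    gap x = next x ∸ x

    gap-periodic : ∀ x → gap (x + N) ≡ gap x
    gap-periodic x = trans (cong (_∸ (x + N)) (next-periodic x))
      (trans (cong₂ _∸_ (+-comm (next x) N) (+-comm x N)) ([m+n]∸[m+o]≡n∸o N (next x) x))

    gap-periodic* : ∀ q x → gap (x + q * N) ≡ gap x
    gap-periodic* zero    x = cong gap (+-identityʳ x)
    gap-periodic* (suc q) x =
      trans (cong gap (trans (cong (x +_) (+-comm N (q * N))) (sym (+-assoc x (q * N) N))))
            (trans (gap-periodic (x + q * N)) (gap-periodic* q x))

    drivesAt-periodic : ∀ s j x → drivesAt c s (x + N) j ≡ drivesAt c s x j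
    drivesAt-periodic s j x = cong₂ _∧_
      (cong (_≡ᵇ j) (sumBelow-cong (sum s) (λ t _ → cong fromBool (shifted (suc t)))))
      (all-cong (partialSums s) shifted)
      where
      shifted : ∀ y → c (x + N + y) ≡ c (x + y)
      shifted y = trans (cong c (trans (+-assoc x N y) (trans (cong (x +_) (+-comm N y)) (sym (+-assoc x y N)))))
                        (periodic (x + y))

    module Units (1∈c : c 1 ≡ true) .{{_ : NonZero N}} where

      next-member : ∀ x → c (next x) ≡ true
      next-member x = nextWithin-hits (suc N) x (N ∸ r) (s≤s (m∸n≤m N r))
                        (trans (cong c reach) (trans (periodic* (suc q) 1) 1∈c))
        where
        r : ℕ
        r = x % N
        q : ℕ
        q = x / N
        reach : x + suc (N ∸ r) ≡ 1 + suc q * N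
        reach = begin
          x + suc (N ∸ r)                ≡⟨ cong (_+ suc (N ∸ r)) (m≡m%n+[m/n]*n x N) ⟩
          r + q * N + suc (N ∸ r)        ≡⟨ +-suc (r + q * N) (N ∸ r) ⟩
          suc (r + q * N + (N ∸ r))      ≡⟨ cong suc (rearrange r (q * N) (N ∸ r)) ⟩
          suc (r + (N ∸ r) + q * N)      ≡⟨ cong (λ z → suc (z + q * N)) (m+[n∸m]≡n (<⇒≤ (m%n<n x N))) ⟩
          1 + suc q * N                  ∎
          where
          open ≡-Reasoning
          rearrange : ∀ a b c → a + b + c ≡ a + c + b
          rearrange a b c = trans (+-assoc a b c) (trans (cong (a +_) (+-comm b c)) (sym (+-assoc a c b)))

      next^ : ℕ → ℕ → ℕ
      next^ zero    x = x
      next^ (suc j) x = next^ j (next x)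

      next^-suc : ∀ j x → next^ (suc j) x ≡ next (next^ j x)
      next^-suc zero    x = refl
      next^-suc (suc j) x = next^-suc j (next x)

      next^-+ : ∀ k t x → next^ (k + t) x ≡ next^ t (next^ k x)
      next^-+ zero    t x = refl
      next^-+ (suc k) t x = next^-+ k t (next x)

      next^-periodic : ∀ j x → next^ j (x + N) ≡ next^ j x + N
      next^-periodic zero    x = refl
      next^-periodic (suc j) x = trans (cong (next^ j) (next-periodic x)) (next^-periodic j (next x))

      ≤next^ : ∀ j x → x ≤ next^ j x
      ≤next^ zero    x = ≤-refl
      ≤next^ (suc j) x = ≤-trans (<⇒≤ (<next x)) (≤next^ j (next x))

      next^-strictMono : ∀ j k x → j < k → next^ j x < next^ k x
      next^-strictMono j (suc k) x (s≤s j≤k) with m≤n⇒m<n∨m≡n j≤k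
      ... | inj₂ refl = subst (next^ j x <_) (sym (next^-suc j x)) (<next (next^ j x))
      ... | inj₁ j<k  = <-trans (next^-strictMono j k x j<k)
                                (subst (next^ k x <_) (sym (next^-suc k x)) (<next (next^ k x)))

      next^-injective : ∀ j k x → next^ j x ≡ next^ k x → j ≡ k
      next^-injective j k x e with <-cmp j k
      ... | tri< j<k _ _ = ⊥-elim (<-irrefl e (next^-strictMono j k x j<k))
      ... | tri≈ _ j≡k _ = j≡k
      ... | tri> _ _ k<j = ⊥-elim (<-irrefl (sym e) (next^-strictMono k j x k<j))

      next^-member : ∀ j x → c (next^ (suc j) x) ≡ true
      next^-member j x = trans (cong c (next^-suc j x)) (next-member (next^ j x))

      next-cases : ∀ x d → (x + d < next x) ⊎ (Σ ℕ λ e → next x ≡ x + suc e × e < d)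
      next-cases x d with next x ≤? x + d
      ... | no  nle = inj₁ (≰⇒> nle)
      ... | yes le  = inj₂ (next x ∸ suc x , next≡ , e<d)
        where
        next≡ : next x ≡ x + suc (next x ∸ suc x)
        next≡ = trans (sym (m+[n∸m]≡n (<next x))) (sym (+-suc x _))
        e<d : next x ∸ suc x < d
        e<d = +-cancelˡ-< x _ _ (subst (_≤ x + d) (trans next≡ (+-suc x _)) le)

      skipped-before-next : ∀ x e t → next x ≡ x + suc e → t < e → c (x + suc t) ≡ false
      skipped-before-next x e t next≡ t<e =
        next-skips x (x + suc t) (m<m+n x z<s) (subst (x + suc t <_) (sym next≡) (+-monoʳ-< x (s<s t<e)))

      skipped-within : ∀ x d t → x + d < next x → t < d → c (x + suc t) ≡ false
      skipped-within x d t lt t<d = next-skips x (x + suc t) (m<m+n x z<s) (≤-<-trans (+-monoʳ-≤ x t<d) lt)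

      shift-suc : ∀ x e t → x + suc e + suc t ≡ x + suc (suc e + t)
      shift-suc x e t = trans (+-assoc x (suc e) (suc t)) (cong (x +_) (cong suc (+-suc e t)))

      countAfter-none : ∀ x d → x + d < next x → countAfter c x d ≡ 0
      countAfter-none x d lt = count-none d _ (λ t t<d → skipped-within x d t lt t<d)

      countAfter-step : ∀ x d e → next x ≡ x + suc e → e < d →
        countAfter c x d ≡ suc (countAfter c (next x) (d ∸ suc e))
      countAfter-step x d e next≡ e<d =
        trans (sumBelow-firstNonzero d e _ e<d (λ t t<e → cong fromBool (skipped-before-next x e t next≡ t<e)))
          (cong₂ _+_ (cong fromBool (trans (cong c (sym next≡)) (next-member x)))
            (sumBelow-cong (d ∸ suc e) (λ t _ → cong (λ z → fromBool (c z))
              (trans (sym (shift-suc x e t)) (cong (_+ suc t) (sym next≡))))))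

      countAfter-+ : ∀ w x S → countAfter c w (x + S) ≡ countAfter c w x + countAfter c (w + x) S
      countAfter-+ w x S = trans (sumBelow-+ x S _) (cong (countAfter c w x +_)
        (sumBelow-cong S (λ i _ → cong (λ z → fromBool (c z))
          (trans (cong (w +_) (sym (+-suc x i))) (sym (+-assoc w x (suc i)))))))

      next^-countAfter′ : ∀ B d x → d ≤ B → (d ≡ 0 ⊎ c (x + d) ≡ true) → next^ (countAfter c x d) x ≡ x + d
      next^-countAfter′ B       zero    x _         _         = sym (+-identityʳ x)
      next^-countAfter′ B       (suc d) x _         (inj₁ ())
      next^-countAfter′ zero    (suc d) x ()        _
      next^-countAfter′ (suc B) (suc d) x (s≤s d≤B) (inj₂ cd) with next-cases x (suc d)
      ... | inj₁ lt with () ← trans (sym cd) (next-skips x (x + suc d) (m<m+n x z<s) lt)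
      ... | inj₂ (e , next≡ , e<d) rewrite countAfter-step x (suc d) e next≡ e<d =
        trans (next^-countAfter′ B (suc d ∸ suc e) (next x) (≤-trans (m∸n≤m d e) d≤B) (inj₂ (trans (cong c lands) cd)))
              lands
        where
        lands : next x + (suc d ∸ suc e) ≡ x + suc d
        lands = trans (cong (_+ (suc d ∸ suc e)) next≡) (trans (+-assoc x (suc e) _) (cong (x +_) (m+[n∸m]≡n e<d)))

      next^-countAfter : ∀ d x → (d ≡ 0 ⊎ c (x + d) ≡ true) → next^ (countAfter c x d) x ≡ x + d
      next^-countAfter d x = next^-countAfter′ d d x ≤-refl

      next^≡⇒countAfter : ∀ j d x → next^ j x ≡ x + d → j ≡ countAfter c x d
      next^≡⇒countAfter zero    d x e = cong (countAfter c x) (sym (+-cancelˡ-≡ x d 0 (trans (sym e) (sym (+-identityʳ x)))))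
      next^≡⇒countAfter (suc j) d x e = next^-injective (suc j) (countAfter c x d) x
        (trans e (sym (next^-countAfter d x (inj₂ (trans (cong c (sym e)) (next^-member j x))))))

      gapWindow : ℕ → ℕ → List ℕ
      gapWindow w j = applyUpTo (λ t → gap (next^ t w)) j

      sumBelow-gap : ∀ k w → sumBelow (λ t → gap (next^ t w)) k ≡ next^ k w ∸ w
      sumBelow-gap zero    w = sym (n∸n≡0 w)
      sumBelow-gap (suc k) w = trans (cong (gap w +_) (sumBelow-gap k (next w)))
        (∸-telescope w (next w) (next^ k (next w)) (<⇒≤ (<next w)) (≤next^ k (next w)))

      sum-take-gapWindow : ∀ k j w → k ≤ j → sum (take k (gapWindow w j)) ≡ next^ k w ∸ w
      sum-take-gapWindow k j w k≤j =
        trans (cong sum (take-applyUpTo _ k j k≤j)) (trans (sum-applyUpTo _ k) (sumBelow-gap k w))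

      drop-gapWindow : ∀ k j w → k ≤ j → drop k (gapWindow w j) ≡ gapWindow (next^ k w) (j ∸ k)
      drop-gapWindow k j w k≤j =
        trans (drop-applyUpTo _ k j k≤j) (applyUpTo-cong (j ∸ k) (λ t _ → cong gap (next^-+ k t w)))

      all-shift : ∀ w x L → all (λ σ → c (w + σ)) (map (x +_) L) ≡ all (λ σ → c (w + x + σ)) L
      all-shift w x L = trans (all-map (λ σ → c (w + σ)) (x +_) L) (all-cong L (λ σ → cong c (sym (+-assoc w x σ))))

      module SplitCons (x : ℕ) (ss : List ℕ)
        (splits-ss : ∀ w j → splits ss (gapWindow w j) ≡ drivesAt c ss w j) (w j : ℕ) where

        S : ℕ
        S = sum ss

        splitAt : ℕ → Bool
        splitAt k = (sum (take k (gapWindow w j)) ≡ᵇ x) ∧ splits ss (drop k (gapWindow w j))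

        splitAt⇒drivesAt : ∀ i → suc i ≤ j → splitAt (suc i) ≡ true → drivesAt c (x ∷ ss) w j ≡ true
        splitAt⇒drivesAt i k≤j h =
          ∧-intro (≡⇒≡ᵇ-true _ _ total)
            (∧-intro (subst (λ z → c z ≡ true) lands (next^-member i w))
              (trans (all-shift w x (partialSums ss))
                (subst (λ z → all (λ σ → c (z + σ)) (partialSums ss) ≡ true) lands (∧-conicalʳ _ _ rest))))
          where
          k : ℕ
          k = suc i
          lands : next^ k w ≡ w + x
          lands = trans (sym (m+[n∸m]≡n (≤next^ k w)))
                        (cong (w +_) (trans (sym (sum-take-gapWindow k j w k≤j)) (≡ᵇ-true⇒≡ _ _ (∧-conicalˡ _ _ h))))
          rest : drivesAt c ss (next^ k w) (j ∸ k) ≡ true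
          rest = trans (sym (splits-ss (next^ k w) (j ∸ k)))
                       (trans (cong (splits ss) (sym (drop-gapWindow k j w k≤j))) (∧-conicalʳ _ _ h))
          total : countAfter c w (x + S) ≡ j
          total = begin
            countAfter c w (x + S)                     ≡⟨ countAfter-+ w x S ⟩
            countAfter c w x + countAfter c (w + x) S  ≡⟨ cong₂ _+_ (sym (next^≡⇒countAfter k x w lands))
                                                             (subst (λ z → countAfter c z S ≡ j ∸ k) lands
                                                               (≡ᵇ-true⇒≡ _ _ (∧-conicalˡ _ _ rest))) ⟩
            k + (j ∸ k)                                ≡⟨ m+[n∸m]≡n k≤j ⟩
            j                                          ∎
            where open ≡-Reasoning

        drivesAt⇒splitAt : 0 < x → drivesAt c (x ∷ ss) w j ≡ true → Σ ℕ λ i → i < j × splitAt (suc i) ≡ true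
        drivesAt⇒splitAt 0<x h = split (countAfter c w x) refl
          where
          total : countAfter c w (x + S) ≡ j
          total = ≡ᵇ-true⇒≡ _ _ (∧-conicalˡ (countAfter c w (x + S) ≡ᵇ j) _ h)
          members : (c (w + x) ∧ all (λ σ → c (w + σ)) (map (x +_) (partialSums ss))) ≡ true
          members = ∧-conicalʳ (countAfter c w (x + S) ≡ᵇ j) _ h
          w+x∈c : c (w + x) ≡ true
          w+x∈c = ∧-conicalˡ (c (w + x)) _ members
          rest-members : all (λ σ → c (w + x + σ)) (partialSums ss) ≡ true
          rest-members = trans (sym (all-shift w x (partialSums ss))) (∧-conicalʳ (c (w + x)) _ members)
          lands : next^ (countAfter c w x) w ≡ w + x
          lands = next^-countAfter x w (inj₂ w+x∈c)
          split-total : countAfter c w x + countAfter c (w + x) S ≡ j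
          split-total = trans (sym (countAfter-+ w x S)) total
          split : ∀ k → countAfter c w x ≡ k → Σ ℕ λ i → i < j × splitAt (suc i) ≡ true
          split zero    k≡ = ⊥-elim (<-irrefl (sym (+-cancelˡ-≡ w x 0
                                 (trans (sym (trans (cong (λ z → next^ z w) (sym k≡)) lands)) (sym (+-identityʳ w))))) 0<x)
          split (suc i) k≡ = i , k≤j , ∧-intro (≡⇒≡ᵇ-true _ _ first-block)
            (trans (cong (splits ss) (drop-gapWindow k j w k≤j))
              (trans (splits-ss (next^ k w) (j ∸ k))
                (subst (λ z → drivesAt c ss z (j ∸ k) ≡ true) (sym landsₖ) rest)))
            where
            k : ℕ
            k = suc i
            landsₖ : next^ k w ≡ w + x
            landsₖ = subst (λ z → next^ z w ≡ w + x) k≡ lands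
            k≤j : k ≤ j
            k≤j = subst (k ≤_) split-total (subst (_≤ countAfter c w x + countAfter c (w + x) S) k≡ (m≤m+n _ _))
            first-block : sum (take k (gapWindow w j)) ≡ x
            first-block = trans (sum-take-gapWindow k j w k≤j) (trans (cong (_∸ w) landsₖ) (m+n∸m≡n w x))
            rest : drivesAt c ss (w + x) (j ∸ k) ≡ true
            rest = ∧-intro (≡⇒≡ᵇ-true _ _ (trans (sym (m+n∸m≡n k _))
                             (cong (_∸ k) (trans (cong (_+ countAfter c (w + x) S) (sym k≡)) split-total))))
                           rest-members

      splits-gapWindow : ∀ s → All (0 <_) s → ∀ w j → splits s (gapWindow w j) ≡ drivesAt c s w j
      splits-gapWindow []       _          w zero    = refl
      splits-gapWindow []       _          w (suc j) = refl
      splits-gapWindow (x ∷ ss) (0<x ∷ pos) w j rewrite length-applyUpTo (λ t → gap (next^ t w)) j =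
        bool-ext
          (λ h → let (i , i<j , hᵢ) = any-applyUpTo⁻ splitAt suc j h in splitAt⇒drivesAt i i<j hᵢ)
          (λ h → let (i , i<j , hᵢ) = drivesAt⇒splitAt 0<x h in any-applyUpTo⁺ splitAt suc j i i<j hᵢ)
        where open SplitCons x ss (splits-gapWindow ss pos) w j

      filterᵇ-skip : ∀ m n y → (∀ i → i < m → c (y + i) ≡ false) →
        filterᵇ c (applyUpTo (λ i → y + i) (m + n)) ≡ filterᵇ c (applyUpTo (λ i → (y + m) + i) n)
      filterᵇ-skip zero    n y h = cong (filterᵇ c) (applyUpTo-cong n (λ i _ → cong (_+ i) (sym (+-identityʳ y))))
      filterᵇ-skip (suc m) n y h rewrite h 0 z<s =
        trans (cong (filterᵇ c) (applyUpTo-cong (m + n) (λ i _ → +-suc y i)))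
          (trans (filterᵇ-skip m n (suc y) (λ i i<m → trans (cong c (sym (+-suc y i))) (h (suc i) (s<s i<m))))
            (cong (filterᵇ c) (applyUpTo-cong n (λ i _ → cong (_+ i) (sym (+-suc y m))))))

      filterᵇ-none : ∀ n y → (∀ i → i < n → c (y + i) ≡ false) → filterᵇ c (applyUpTo (λ i → y + i) n) ≡ []
      filterᵇ-none n y h =
        trans (cong (λ z → filterᵇ c (applyUpTo (λ i → y + i) z)) (sym (+-identityʳ n))) (filterᵇ-skip n 0 y h)

      filterᵇ-fromMember′ : ∀ B d x → d ≤ B → c x ≡ true →
        filterᵇ c (applyUpTo (λ i → x + i) (suc d)) ≡ applyUpTo (λ i → next^ i x) (suc (countAfter c x d))
      filterᵇ-fromMember′ B d x d≤B x∈c rewrite +-identityʳ x | x∈c = cong (x ∷_) (after B d x d≤B)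
        where
        after : ∀ B d x → d ≤ B →
          filterᵇ c (applyUpTo (λ i → x + suc i) d) ≡ applyUpTo (λ i → next^ (suc i) x) (countAfter c x d)
        after B d x d≤B with next-cases x d
        ... | inj₁ lt rewrite countAfter-none x d lt =
          trans (cong (filterᵇ c) (applyUpTo-cong d (λ i _ → +-suc x i)))
                (filterᵇ-none d (suc x) (λ i i<d → trans (cong c (sym (+-suc x i))) (skipped-within x d i lt i<d)))
        after zero    d x d≤B | inj₂ (e , next≡ , e<d) = ⊥-elim (<⇒≱ (≤-trans e<d d≤B) z≤n)
        after (suc B) d x d≤B | inj₂ (e , next≡ , e<d) rewrite countAfter-step x d e next≡ e<d =
          trans (cong (filterᵇ c) (applyUpTo-cong d (λ i _ → +-suc x i)))
          (trans (cong (λ z → filterᵇ c (applyUpTo (λ i → suc x + i) z)) (sym (m+[n∸m]≡n (<⇒≤ e<d))))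
          (trans (filterᵇ-skip e (d ∸ e) (suc x) (λ i i<e → trans (cong c (sym (+-suc x i))) (skipped-before-next x e i next≡ i<e)))
          (trans (cong (filterᵇ c) (applyUpTo-cong (d ∸ e) (λ i _ → cong (_+ i) (trans (sym (+-suc x e)) (sym next≡)))))
          (trans (cong (λ z → filterᵇ c (applyUpTo (λ i → next x + i) z)) (+-∸-assoc 1 e<d))
            (filterᵇ-fromMember′ B (d ∸ suc e) (next x) (≤-trans (∸-monoʳ-≤ d (s≤s (z≤n {e}))) (∸-monoˡ-≤ 1 d≤B))
              (next-member x))))))

      filterᵇ-fromMember : ∀ d x → c x ≡ true →
        filterᵇ c (applyUpTo (λ i → x + i) (suc d)) ≡ applyUpTo (λ i → next^ i x) (suc (countAfter c x d))
      filterᵇ-fromMember d x = filterᵇ-fromMember′ d d x ≤-refl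

      unit : ℕ → ℕ
      unit i = next^ i 1

      φ : ℕ
      φ = countAfter c 1 N

      unit-φ : unit φ ≡ 1 + N
      unit-φ = next^-countAfter N 1 (inj₂ (trans (periodic 1) 1∈c))

      φ≢0 : φ ≢ 0
      φ≢0 φ≡0 = ≢-nonZero⁻¹ N (+-cancelˡ-≡ 1 N 0 (trans (sym unit-φ) (cong (λ z → next^ z 1) φ≡0)))

      instance
        φ-nonZero : NonZero φ
        φ-nonZero = ≢-nonZero φ≢0

      gapList : List ℕ
      gapList = diffs (filterᵇ c (applyUpTo suc (suc N)))

      gapList≡ : gapList ≡ applyUpTo (λ i → gap (unit i)) φ
      gapList≡ = trans (cong diffs (filterᵇ-fromMember N 1 1∈c))
        (trans (diffs-applyUpTo unit φ) (applyUpTo-cong φ (λ i _ → cong (_∸ unit i) (next^-suc i 1))))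

      unit-periodic : ∀ q r → unit (r + q * φ) ≡ unit r + q * N
      unit-periodic zero    r = trans (cong unit (+-identityʳ r)) (sym (+-identityʳ (unit r)))
      unit-periodic (suc q) r = begin
        next^ (r + (φ + q * φ)) 1     ≡⟨ cong (λ z → next^ z 1) (swap-front r φ (q * φ)) ⟩
        next^ (φ + (r + q * φ)) 1     ≡⟨ next^-+ φ (r + q * φ) 1 ⟩
        next^ (r + q * φ) (unit φ)    ≡⟨ cong (next^ (r + q * φ)) unit-φ ⟩
        next^ (r + q * φ) (1 + N)     ≡⟨ next^-periodic (r + q * φ) 1 ⟩
        unit (r + q * φ) + N          ≡⟨ cong (_+ N) (unit-periodic q r) ⟩
        unit r + q * N + N            ≡⟨ trans (+-assoc (unit r) (q * N) N) (cong (unit r +_) (+-comm (q * N) N)) ⟩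
        unit r + (N + q * N)          ∎
        where
        open ≡-Reasoning
        swap-front : ∀ a b c → a + (b + c) ≡ b + (a + c)
        swap-front a b c = trans (sym (+-assoc a b c)) (trans (cong (_+ c) (+-comm a b)) (+-assoc b a c))

      cyc-gapList : ∀ m → cyc (applyUpTo (λ i → gap (unit i)) φ) m ≡ gap (unit m)
      cyc-gapList m = trans (cyc-applyUpTo (λ i → gap (unit i)) φ m)
        (trans (sym (gap-periodic* (m / φ) (unit (m % φ))))
          (cong gap (trans (sym (unit-periodic (m / φ) (m % φ))) (cong unit (sym (m≡m%n+[m/n]*n m φ))))))

      module _ (D : ℕ → Bool) where

        count-next^′ : ∀ B d x → d ≤ B → c x ≡ true →
          count (λ i → D (next^ i x)) (suc (countAfter c x d)) ≡ count (λ t → c (x + t) ∧ D (x + t)) (suc d)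
        count-next^′ B d x d≤B x∈c = cong₂ _+_ (sym first) (after B d x d≤B)
          where
          first : fromBool (c (x + 0) ∧ D (x + 0)) ≡ fromBool (D x)
          first rewrite +-identityʳ x | x∈c = refl
          after : ∀ B d x → d ≤ B →
            count (λ i → D (next^ i (next x))) (countAfter c x d) ≡ count (λ t → c (x + suc t) ∧ D (x + suc t)) d
          after B d x d≤B with next-cases x d
          ... | inj₁ lt rewrite countAfter-none x d lt =
            sym (count-none d _ (λ t t<d → cong (_∧ D (x + suc t)) (skipped-within x d t lt t<d)))
          after zero    d x d≤B | inj₂ (e , next≡ , e<d) = ⊥-elim (<⇒≱ (≤-trans e<d d≤B) z≤n)
          after (suc B) d x d≤B | inj₂ (e , next≡ , e<d) rewrite countAfter-step x d e next≡ e<d =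
            trans (count-next^′ B (d ∸ suc e) (next x) (≤-trans (∸-monoʳ-≤ d (s≤s (z≤n {e}))) (∸-monoˡ-≤ 1 d≤B))
                                (next-member x))
              (sym (trans (sumBelow-firstNonzero d e _ e<d
                             (λ t t<e → cong (λ b → fromBool (b ∧ D (x + suc t))) (skipped-before-next x e t next≡ t<e)))
                (cong₂ _+_ (cong (λ z → fromBool (c z ∧ D z)) (trans (sym next≡) (sym (+-identityʳ _))))
                  (sumBelow-cong (d ∸ suc e) (λ t _ → cong (λ z → fromBool (c z ∧ D z))
                    (trans (sym (shift-suc x e t)) (cong (_+ suc t) (sym next≡))))))))

        count-units : (∀ x → D (x + N) ≡ D x) → count (λ i → D (unit i)) φ ≡ count (λ t → c t ∧ D t) N
        count-units D-periodic = trans without-ends (sumBelow-rotate N (λ t → fromBool (c t ∧ D t)) wraps)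
          where
          wraps : fromBool (c 0 ∧ D 0) ≡ fromBool (c N ∧ D N)
          wraps = cong fromBool (cong₂ _∧_ (sym (periodic 0)) (sym (D-periodic 0)))
          with-ends : count (λ i → D (unit i)) φ + fromBool (D (unit φ))
                    ≡ count (λ t → c (suc t) ∧ D (suc t)) N + fromBool (c (1 + N) ∧ D (1 + N))
          with-ends = trans (sym (sumBelow-suc φ _)) (trans (count-next^′ N N 1 ≤-refl 1∈c) (sumBelow-suc N _))
          last : fromBool (D (unit φ)) ≡ fromBool (c (1 + N) ∧ D (1 + N))
          last = trans (cong (λ z → fromBool (D z)) unit-φ)
                       (cong (λ b → fromBool (b ∧ D (1 + N))) (sym (trans (periodic 1) 1∈c)))
          without-ends : count (λ i → D (unit i)) φ ≡ count (λ t → c (suc t) ∧ D (suc t)) N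
          without-ends = +-cancelʳ-≡ _ _ _ (trans with-ends (cong (count (λ t → c (suc t) ∧ D (suc t)) N +_) (sym last)))

      count-drivingTerms : ∀ s → All (0 <_) s → ∀ j →
        length (filterᵇ (λ i → splits s (window gapList i j)) (upTo (length gapList))) ≡ periodCount c N s j
      count-drivingTerms s pos j = begin
        length (filterᵇ (λ i → splits s (window gapList i j)) (upTo (length gapList)))
          ≡⟨ cong (λ L → length (filterᵇ (λ i → splits s (window L i j)) (upTo (length L)))) gapList≡ ⟩
        length (filterᵇ (λ i → splits s (window gaps′ i j)) (upTo (length gaps′)))
          ≡⟨ cong (λ n → length (filterᵇ (λ i → splits s (window gaps′ i j)) (upTo n))) (length-applyUpTo _ φ) ⟩
        length (filterᵇ (λ i → splits s (window gaps′ i j)) (upTo φ))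
          ≡⟨ length-filterᵇ-applyUpTo (λ i → splits s (window gaps′ i j)) (λ i → i) φ ⟩
        count (λ i → splits s (window gaps′ i j)) φ
          ≡⟨ sumBelow-cong φ (λ i _ → cong fromBool (trans (cong (splits s) (window≡ i))
                                                           (splits-gapWindow s pos (unit i) j))) ⟩
        count (λ i → drivesAt c s (unit i) j) φ
          ≡⟨ count-units (λ w → drivesAt c s w j) (drivesAt-periodic s j) ⟩
        periodCount c N s j ∎
        where
        open ≡-Reasoning
        gaps′ : List ℕ
        gaps′ = applyUpTo (λ i → gap (unit i)) φ
        window≡ : ∀ i → window gaps′ i j ≡ gapWindow (unit i) j
        window≡ i = trans (map-upTo (λ t → cyc gaps′ (i + t)) j)
          (applyUpTo-cong j (λ t _ → trans (cyc-gapList (i + t)) (cong gap (next^-+ i t 1))))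

module Sieve where

  open import Data.Nat
  open import Data.Nat.Properties
  open FiniteSums

  member : ℕ → List ℕ → Bool
  member t L = any (λ y → t ≡ᵇ y) L

  member-head : ∀ x L → member x (x ∷ L) ≡ true
  member-head x L rewrite ≡⇒≡ᵇ-true x x refl = refl

  member-tail : ∀ x σ L → member σ L ≡ true → member σ (x ∷ L) ≡ true
  member-tail x σ L e rewrite e with σ ≡ᵇ x
  ... | true  = refl
  ... | false = refl

  all-intro : ∀ (P : ℕ → Bool) L → (∀ σ → member σ L ≡ true → P σ ≡ true) → all P L ≡ true
  all-intro P []      h = refl
  all-intro P (x ∷ L) h = ∧-intro (h x (member-head x L)) (all-intro P L (λ σ e → h σ (member-tail x σ L e)))

  all-elim : ∀ (P : ℕ → Bool) L → all P L ≡ true → ∀ σ → member σ L ≡ true → P σ ≡ true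
  all-elim P (x ∷ L) h σ e with σ ≡ᵇ x in σ≡ᵇx
  ... | true  = subst (λ z → P z ≡ true) (sym (≡ᵇ-true⇒≡ σ x σ≡ᵇx)) (∧-conicalˡ (P x) _ h)
  ... | false = all-elim P L (∧-conicalʳ (P x) _ h) σ e

  all-∧ : ∀ (P Q : ℕ → Bool) L → all (λ σ → P σ ∧ Q σ) L ≡ (all P L ∧ all Q L)
  all-∧ P Q []      = refl
  all-∧ P Q (x ∷ L) rewrite all-∧ P Q L = interchange (P x) (Q x) (all P L) (all Q L)
    where
    interchange : ∀ a b c d → ((a ∧ b) ∧ (c ∧ d)) ≡ ((a ∧ c) ∧ (b ∧ d))
    interchange true  true  c d = refl
    interchange true  false c d = sym (∧-zeroʳ c)
    interchange false b     c d = refl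

  all-not≡count≡ᵇ0 : ∀ L R (Q : ℕ → Bool) → (∀ σ → member σ L ≡ true → σ < R) →
    all (λ σ → not (Q σ)) L ≡ (count (λ t → member t L ∧ Q t) R ≡ᵇ 0)
  all-not≡count≡ᵇ0 L R Q inR = bool-ext
    (λ h → ≡⇒≡ᵇ-true _ 0 (count-none R _ (λ t _ → unmarked t h)))
    (λ h → all-intro _ L (λ σ e → unmarked′ σ e (sumBelow≡0⇒ R _ (≡ᵇ-true⇒≡ _ 0 h) σ (inR σ e))))
    where
    unmarked : ∀ t → all (λ σ → not (Q σ)) L ≡ true → (member t L ∧ Q t) ≡ false
    unmarked t h with member t L in e
    ... | false = refl
    ... | true  with Q t | all-elim _ L h t e
    ... | false | _ = refl
    unmarked′ : ∀ σ → member σ L ≡ true → fromBool (member σ L ∧ Q σ) ≡ 0 → not (Q σ) ≡ true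
    unmarked′ σ e z rewrite e with Q σ
    ... | false = refl

  data Increasing : List ℕ → Set where
    []  : Increasing []
    _∷_ : ∀ {x L} → (∀ t → member t L ≡ true → x < t) → Increasing L → Increasing (x ∷ L)

  count-member : ∀ L R → Increasing L → (∀ σ → member σ L ≡ true → σ < R) → count (λ t → member t L) R ≡ length L
  count-member []      R _            _   = count-none R _ (λ _ _ → refl)
  count-member (x ∷ L) R (x< ∷ inc) inR =
    trans (count-∨ R (λ t → t ≡ᵇ x) (λ t → member t L) disjoint)
          (cong₂ _+_ (count-≡ᵇ R x (inR x (member-head x L))) (count-member L R inc (λ σ e → inR σ (member-tail x σ L e))))
    where
    disjoint : ∀ t → t < R → ((t ≡ᵇ x) ∧ member t L) ≡ false
    disjoint t _ with t ≡ᵇ x in t≡ᵇx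
    ... | false = refl
    ... | true  = ≢true⇒≡false (λ e → <-irrefl (sym (≡ᵇ-true⇒≡ t x t≡ᵇx)) (x< t e))

  fromBool-≡ᵇ-subst : ∀ n m (f : ℕ → ℕ) → fromBool (n ≡ᵇ m) * f n ≡ fromBool (n ≡ᵇ m) * f m
  fromBool-≡ᵇ-subst n m f with n ≡ᵇ m in n≡ᵇm
  ... | true  = cong (λ z → f z + 0) (≡ᵇ-true⇒≡ n m n≡ᵇm)
  ... | false = refl

  survivor-indicator : ∀ n j K KS → K ≤ 1 → KS ≤ K →
    fromBool ((KS ≡ᵇ 0) ∧ (n ∸ K ≡ᵇ suc j))
      ≡ fromBool (n ≡ᵇ suc j) * (1 ∸ K) + fromBool (n ≡ᵇ suc (suc j)) * (K ∸ KS)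
  survivor-indicator n j zero          zero          _         _ =
    sym (trans (cong₂ _+_ (*-identityʳ (fromBool (n ≡ᵇ suc j))) (*-zeroʳ (fromBool (n ≡ᵇ suc (suc j))))) (+-identityʳ _))
  survivor-indicator n j (suc zero)    zero          _         _ =
    sym (trans (cong₂ _+_ (*-zeroʳ (fromBool (n ≡ᵇ suc j))) (*-identityʳ _)) (pred-≡ᵇ n))
    where
    pred-≡ᵇ : ∀ n → fromBool (n ≡ᵇ suc (suc j)) ≡ fromBool (n ∸ 1 ≡ᵇ suc j)
    pred-≡ᵇ zero    = refl
    pred-≡ᵇ (suc n) = refl
  survivor-indicator n j (suc zero)    (suc zero)    _         _ =
    sym (cong₂ _+_ (*-zeroʳ (fromBool (n ≡ᵇ suc j))) (*-zeroʳ (fromBool (n ≡ᵇ suc (suc j)))))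
  survivor-indicator n j (suc (suc K)) KS            (s≤s ()) _
  survivor-indicator n j zero          (suc KS)      _         ()
  survivor-indicator n j (suc zero)    (suc (suc _)) _         (s≤s ())

  -- A window of slots t ≤ S: unit t marks its units, removes m t the slots removed by the shift m < p,
  -- and every slot listed in required has to survive.
  module Removal (p S : ℕ) (required : List ℕ) (unit : ℕ → Bool) (removes : ℕ → ℕ → Bool)
    (removes-one : ∀ m t t′ → m < p → t < suc S → t′ < suc S → unit t ≡ true → unit t′ ≡ true →
                   removes m t ≡ true → removes m t′ ≡ true → t ≡ t′)
    (removed-once : ∀ t → t < suc S → count (λ m → removes m t) p ≡ 1)
    (required-in : ∀ σ → member σ required ≡ true → σ < suc S)
    (required-increasing : Increasing required) where

    R : ℕ
    R = suc S

    units : ℕ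
    units = count unit R

    removed : ℕ → ℕ
    removed m = count (λ t → unit t ∧ removes m t) R

    removedRequired : ℕ → ℕ
    removedRequired m = count (λ t → member t required ∧ removes m t) R

    allRequired : Bool
    allRequired = all unit required

    survives : ℕ → ℕ → ℕ
    survives j m = fromBool (all (λ σ → unit σ ∧ not (removes m σ)) required
                             ∧ (count (λ t → unit t ∧ not (removes m t)) R ≡ᵇ suc j))

    removed≤1 : ∀ m → m < p → removed m ≤ 1
    removed≤1 m m<p = count≤1 R _ (λ t t′ t<R t′<R e e′ →
      removes-one m t t′ m<p t<R t′<R (∧-conicalˡ (unit t) _ e) (∧-conicalˡ (unit t′) _ e′)
                                    (∧-conicalʳ (unit t) _ e) (∧-conicalʳ (unit t′) _ e′))

    sum-removed-on : ∀ (W : ℕ → Bool) → sumBelow (λ m → count (λ t → W t ∧ removes m t) R) p ≡ count W R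
    sum-removed-on W = trans (sumBelow-swap p R (λ m t → fromBool (W t ∧ removes m t)))
      (sumBelow-cong R {g = λ t → fromBool (W t)} (λ t t<R → begin
        sumBelow (λ m → fromBool (W t ∧ removes m t)) p           ≡⟨ sumBelow-cong p (λ m _ → fromBool-∧ (W t) (removes m t)) ⟩
        sumBelow (λ m → fromBool (W t) * fromBool (removes m t)) p ≡⟨ sumBelow-*ˡ p (fromBool (W t)) _ ⟩
        fromBool (W t) * count (λ m → removes m t) p              ≡⟨ cong (fromBool (W t) *_) (removed-once t t<R) ⟩
        fromBool (W t) * 1                                        ≡⟨ *-identityʳ (fromBool (W t)) ⟩
        fromBool (W t)                                            ∎))
      where open ≡-Reasoning

    sum-removedRequired : sumBelow removedRequired p ≡ length required
    sum-removedRequired =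
      trans (sum-removed-on (λ t → member t required)) (count-member required R required-increasing required-in)

    removedRequired≤removed : allRequired ≡ true → ∀ m → removedRequired m ≤ removed m
    removedRequired≤removed all-units m = sumBelow-mono R (λ t _ → pointwise t)
      where
      pointwise : ∀ t → fromBool (member t required ∧ removes m t) ≤ fromBool (unit t ∧ removes m t)
      pointwise t with member t required in e
      ... | false = z≤n
      ... | true rewrite all-elim unit required all-units t e = ≤-refl

    survives≡ : allRequired ≡ true → ∀ j m →
      survives j m ≡ fromBool ((removedRequired m ≡ᵇ 0) ∧ (units ∸ removed m ≡ᵇ suc j))
    survives≡ all-units j m = cong fromBool (cong₂ _∧_
      (trans (all-∧ unit (λ σ → not (removes m σ)) required)
        (trans (cong (_∧ all (λ σ → not (removes m σ)) required) all-units)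
          (all-not≡count≡ᵇ0 required R (removes m) required-in)))
      (cong (_≡ᵇ suc j) (trans (sym (m+n∸n≡m (count (λ t → unit t ∧ not (removes m t)) R) (removed m)))
                               (cong (_∸ removed m) (sym (count-split R unit (removes m)))))))

    survives-none : allRequired ≡ false → ∀ j m → survives j m ≡ 0
    survives-none no-units j m rewrite all-∧ unit (λ σ → not (removes m σ)) required | no-units = refl

    sum-1∸removed : sumBelow (λ m → 1 ∸ removed m) p + units ≡ p
    sum-1∸removed = trans (cong (sumBelow (λ m → 1 ∸ removed m) p +_) (sym (sum-removed-on unit)))
      (trans (sumBelow-∸ p (λ _ → 1) removed removed≤1) (trans (sumBelow-const p 1) (*-identityʳ p)))

    sum-removed∸removedRequired : allRequired ≡ true →
      sumBelow (λ m → removed m ∸ removedRequired m) p ≡ units ∸ length required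
    sum-removed∸removedRequired all-units =
      trans (sym (m+n∸n≡m (sumBelow (λ m → removed m ∸ removedRequired m) p) (sumBelow removedRequired p)))
        (cong₂ _∸_ (trans (sumBelow-∸ p removed removedRequired (λ m _ → removedRequired≤removed all-units m))
                          (sum-removed-on unit))
                   sum-removedRequired)

    count-survivors : ∀ j →
      sumBelow (survives j) p + fromBool (allRequired ∧ (units ≡ᵇ suc j)) * suc j
        ≡ fromBool (allRequired ∧ (units ≡ᵇ suc j)) * p
          + fromBool (allRequired ∧ (units ≡ᵇ suc (suc j))) * (suc (suc j) ∸ length required)
    count-survivors j with allRequired in all-units
    ... | false = trans (+-identityʳ _) (sumBelow-zero p _ (λ m _ → survives-none all-units j m))
    ... | true  = begin
      sumBelow (survives j) p + e₁ * suc j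
        ≡⟨ cong (_+ e₁ * suc j) (trans (sumBelow-cong p (λ m m<p → trans (survives≡ all-units j m)
              (survivor-indicator units j (removed m) (removedRequired m) (removed≤1 m m<p)
                                  (removedRequired≤removed all-units m))))
            (trans (sumBelow-distrib-+ p _ _) (cong₂ _+_ (sumBelow-*ˡ p e₁ (λ m → 1 ∸ removed m))
                                                         (sumBelow-*ˡ p e₂ (λ m → removed m ∸ removedRequired m))))) ⟩
      e₁ * Σ₁ + e₂ * sumBelow (λ m → removed m ∸ removedRequired m) p + e₁ * suc j
        ≡⟨ cong (λ z → e₁ * Σ₁ + e₂ * z + e₁ * suc j) (sum-removed∸removedRequired all-units) ⟩
      e₁ * Σ₁ + e₂ * (units ∸ length required) + e₁ * suc j
        ≡⟨ cong (λ z → e₁ * Σ₁ + z + e₁ * suc j) (fromBool-≡ᵇ-subst units (suc (suc j)) (_∸ length required)) ⟩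
      e₁ * Σ₁ + e₂ * (suc (suc j) ∸ length required) + e₁ * suc j
        ≡⟨ +-comm-middle (e₁ * Σ₁) (e₂ * (suc (suc j) ∸ length required)) (e₁ * suc j) ⟩
      (e₁ * Σ₁ + e₁ * suc j) + e₂ * (suc (suc j) ∸ length required)
        ≡⟨ cong (_+ e₂ * (suc (suc j) ∸ length required))
                (trans (cong (e₁ * Σ₁ +_) (sym (fromBool-≡ᵇ-subst units (suc j) (λ z → z))))
                       (trans (sym (*-distribˡ-+ e₁ Σ₁ units)) (cong (e₁ *_) sum-1∸removed))) ⟩
      e₁ * p + e₂ * (suc (suc j) ∸ length required) ∎
      where
      open ≡-Reasoning
      e₁ : ℕ
      e₁ = fromBool (units ≡ᵇ suc j)
      e₂ : ℕ
      e₂ = fromBool (units ≡ᵇ suc (suc j))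
      Σ₁ : ℕ
      Σ₁ = sumBelow (λ m → 1 ∸ removed m) p
      +-comm-middle : ∀ x y z → x + y + z ≡ (x + z) + y
      +-comm-middle x y z = trans (+-assoc x y z) (trans (cong (x +_) (+-comm y z)) (sym (+-assoc x z y)))

module Residues where

  open import Data.Nat
  open import Data.Nat.Properties
  open import Data.Nat.DivMod
  open import Data.Nat.Divisibility
  open import Data.Nat.Primality
  open import Data.Nat.Coprimality using (Coprime; coprime-Bézout)
  open import Data.Nat.GCD using (module Bézout)
  open import Data.Nat.Tactic.RingSolver using (solve-∀)

  prime∤⇒coprime : ∀ {p} N → Prime p → ¬ p ∣ N → Coprime N p
  prime∤⇒coprime N pp p∤N {d} (d∣N , d∣p) with prime⇒irreducible pp d∣p
  ... | inj₁ d≡1 = d≡1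
  ... | inj₂ refl = ⊥-elim (p∤N d∣N)

  ∣-reduce : ∀ p N a m .{{_ : NonZero p}} → p ∣ m * N + a → p ∣ (m % p) * N + a
  ∣-reduce p N a m h = ∣m+n∣m⇒∣n (subst (p ∣_) split h) (∣m⇒∣m*n N (n∣m*n (m / p)))
    where
    split : m * N + a ≡ (m / p) * p * N + ((m % p) * N + a)
    split = begin
      m * N + a                               ≡⟨ cong (λ z → z * N + a) (m≡m%n+[m/n]*n m p) ⟩
      (m % p + (m / p) * p) * N + a           ≡⟨ rearrange (m % p) ((m / p) * p) N a ⟩
      (m / p) * p * N + ((m % p) * N + a)     ∎
      where
      open ≡-Reasoning
      rearrange : ∀ r q N a → (r + q) * N + a ≡ q * N + (r * N + a)
      rearrange = solve-∀

  -- From Bézout's identity 1 + x N = y p (resp. 1 + y p = x N), m = a x (resp. a (p - 1) x) has p ∣ m N + a.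
  residue-exists : ∀ p N a → .{{_ : NonZero p}} → Coprime N p → Σ ℕ λ m → m < p × p ∣ m * N + a
  residue-exists p@(suc p′) N a cop with coprime-Bézout cop
  ... | Bézout.-+ x y eq =
    (a * x) % p , m%n<n (a * x) p ,
    ∣-reduce p N a (a * x) (divides (a * y) (trans (ring₁ a x N) (trans (cong (a *_) eq) (sym (*-assoc a y p)))))
    where
    ring₁ : ∀ a x N → a * x * N + a ≡ a * (1 + x * N)
    ring₁ = solve-∀
  ... | Bézout.+- x y eq =
    (a * p′ * x) % p , m%n<n (a * p′ * x) p , ∣-reduce p N a (a * p′ * x) (divides (a + a * p′ * y)
      (trans (cong (_+ a) (*-assoc (a * p′) x N)) (trans (cong (λ z → a * p′ * z + a) (sym eq)) (ring₂ a y p′))))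
    where
    ring₂ : ∀ a y p′ → a * p′ * (1 + y * suc p′) + a ≡ (a + a * p′ * y) * suc p′
    ring₂ = solve-∀

  residues-distinct : ∀ p N a m m′ → Prime p → ¬ p ∣ N → m < m′ → m′ < p →
    p ∣ m * N + a → p ∣ m′ * N + a → ⊥
  residues-distinct p N a m m′ pp p∤N m<m′ m′<p h h′
    with euclidsLemma (m′ ∸ m) N pp (∣m+n∣m⇒∣n (subst (p ∣_) split h′) h)
    where
    split : m′ * N + a ≡ (m * N + a) + (m′ ∸ m) * N
    split = trans (cong (λ z → z * N + a) (sym (m+[n∸m]≡n (<⇒≤ m<m′)))) (rearrange m (m′ ∸ m) N a)
      where
      rearrange : ∀ m d N a → (m + d) * N + a ≡ (m * N + a) + d * N
      rearrange = solve-∀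
  ... | inj₂ p∣N = p∤N p∣N
  ... | inj₁ p∣d = <⇒≱ (≤-<-trans (m∸n≤m m′ m) m′<p) (∣⇒≤ {{>-nonZero (m<n⇒0<n∸m m<m′)}} p∣d)

  residue-unique : ∀ p N a m m′ → Prime p → ¬ p ∣ N → m < p → m′ < p →
    p ∣ m * N + a → p ∣ m′ * N + a → m ≡ m′
  residue-unique p N a m m′ pp p∤N m<p m′<p h h′ with <-cmp m m′
  ... | tri< lt _ _ = ⊥-elim (residues-distinct p N a m m′ pp p∤N lt m′<p h h′)
  ... | tri≈ _ e _  = e
  ... | tri> _ _ gt = ⊥-elim (residues-distinct p N a m′ m pp p∤N gt m<p h′ h)

  odd%2 : ∀ x → ¬ 2 ∣ x → x % 2 ≡ 1
  odd%2 x h with x % 2 | m%n<n x 2 | m%n≡0⇒n∣m x 2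
  ... | 0           | _               | 2∣x = ⊥-elim (h (2∣x refl))
  ... | 1           | _               | _   = refl
  ... | suc (suc _) | s≤s (s≤s ())    | _

  odd+odd : ∀ x y → ¬ 2 ∣ x → ¬ 2 ∣ y → 2 ∣ x + y
  odd+odd x y hx hy = m%n≡0⇒n∣m (x + y) 2
    (trans (%-distribˡ-+ x y 2) (cong₂ (λ u v → (u + v) % 2) (odd%2 x hx) (odd%2 y hy)))

module Lifting where

  open import Data.Nat
  open import Data.Nat.Properties
  open import Data.Nat.Divisibility
  open import Data.Nat.Primality
  open import Data.Nat.ListAction using (sum)
  open FiniteSums
  open ListFacts using (all-cong)
  open GapCycle using (partialSums; countAfter; drivesAt; periodCount; module Periodic)
  open Sieve
  open Residues

  drivesAt-window : ∀ c s w j → fromBool (c w ∧ drivesAt c s w j)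
    ≡ fromBool (all (λ σ → c (w + σ)) (0 ∷ partialSums s) ∧ (count (λ t → c (w + t)) (suc (sum s)) ≡ᵇ suc j))
  drivesAt-window c s w j rewrite +-identityʳ w with c w
  ... | false = refl
  ... | true  = cong fromBool (∧-comm (countAfter c w (sum s) ≡ᵇ j) _)

  partialSumsFrom : ℕ → List ℕ → List ℕ
  partialSumsFrom o []       = []
  partialSumsFrom o (x ∷ ss) = (o + x) ∷ partialSumsFrom (o + x) ss

  map-partialSums : ∀ o s → map (o +_) (partialSums s) ≡ partialSumsFrom o s
  map-partialSums o []       = refl
  map-partialSums o (x ∷ ss) = cong ((o + x) ∷_)
    (trans (sym (map-∘ (partialSums ss))) (trans (map-cong (λ y → sym (+-assoc o x y)) (partialSums ss))
                                                 (map-partialSums (o + x) ss)))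

  partialSums≡From0 : ∀ s → partialSums s ≡ partialSumsFrom 0 s
  partialSums≡From0 []       = refl
  partialSums≡From0 (x ∷ ss) = cong (x ∷_) (map-partialSums x ss)

  partialSumsFrom-bounds : ∀ s → All (0 <_) s → ∀ o t → member t (partialSumsFrom o s) ≡ true → o < t × t ≤ o + sum s
  partialSumsFrom-bounds (x ∷ ss) (0<x ∷ pos) o t e with t ≡ᵇ (o + x) in t≡ᵇ
  ... | true rewrite ≡ᵇ-true⇒≡ t (o + x) t≡ᵇ = m<m+n o 0<x , +-monoʳ-≤ o (m≤m+n x (sum ss))
  ... | false with partialSumsFrom-bounds ss pos (o + x) t e
  ... | lt , le = <-trans (m<m+n o 0<x) lt , ≤-trans le (≤-reflexive (+-assoc o x (sum ss)))

  partialSumsFrom-increasing : ∀ s → All (0 <_) s → ∀ o → Increasing (partialSumsFrom o s)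
  partialSumsFrom-increasing []       _           o = []
  partialSumsFrom-increasing (x ∷ ss) (0<x ∷ pos) o =
    (λ t e → proj₁ (partialSumsFrom-bounds ss pos (o + x) t e)) ∷ partialSumsFrom-increasing ss pos (o + x)

  required-bounded : ∀ s → All (0 <_) s → ∀ σ → member σ (0 ∷ partialSums s) ≡ true → σ < suc (sum s)
  required-bounded s pos σ e with σ ≡ᵇ 0 in σ≡ᵇ0
  ... | true rewrite ≡ᵇ-true⇒≡ σ 0 σ≡ᵇ0 = s≤s z≤n
  ... | false = s≤s (proj₂ (partialSumsFrom-bounds s pos 0 σ (subst (λ L → member σ L ≡ true) (partialSums≡From0 s) e)))

  required-increasing : ∀ s → All (0 <_) s → Increasing (0 ∷ partialSums s)
  required-increasing s pos =
    (λ t e → proj₁ (partialSumsFrom-bounds s pos 0 t (subst (λ L → member t L ≡ true) (partialSums≡From0 s) e)))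
    ∷ subst Increasing (sym (partialSums≡From0 s)) (partialSumsFrom-increasing s pos 0)

  length-partialSums : ∀ s → length (partialSums s) ≡ length s
  length-partialSums []       = refl
  length-partialSums (x ∷ ss) = cong suc (trans (length-map (x +_) (partialSums ss)) (length-partialSums ss))

  -- c marks the units modulo N and c′ those modulo p N.
  module Lift (N p : ℕ) (c c′ : ℕ → Bool)
    (periodic : ∀ x → c (x + N) ≡ c x)
    (c′-def : ∀ x → c′ x ≡ c x ∧ not (does (p ∣? x)))
    (units-odd : ∀ x → c x ≡ true → ¬ 2 ∣ x)
    (pp : Prime p) (p-odd : ¬ 2 ∣ p) (p∤N : ¬ p ∣ N)
    (s : List ℕ) (pos : All (0 <_) s) (short : sum s < 2 * p) where

    instance
      p-nonZero : NonZero p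
      p-nonZero = prime⇒nonZero pp

    S : ℕ
    S = sum s

    required : List ℕ
    required = 0 ∷ partialSums s

    open Periodic c N periodic using (periodic*)

    divisible-units-coincide : ∀ x d → c x ≡ true → c (x + d) ≡ true → p ∣ x → p ∣ x + d → d < 2 * p → d ≡ 0
    divisible-units-coincide x d x∈c x+d∈c p∣x p∣x+d d<2p with ∣m+n∣m⇒∣n p∣x+d p∣x
    ... | divides zero          d≡0 = d≡0
    ... | divides (suc zero)    d≡p = ⊥-elim (units-odd (x + d) x+d∈c
            (subst (λ z → 2 ∣ x + z) (sym (trans d≡p (+-identityʳ p))) (odd+odd x p (units-odd x x∈c) p-odd)))
    ... | divides (suc (suc q)) d≡  = ⊥-elim (<⇒≱ d<2p
            (subst (2 * p ≤_) (sym d≡) (≤-trans (≤-reflexive (cong (p +_) (+-identityʳ p))) (+-monoʳ-≤ p (m≤m+n p (q * p))))))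

    module AtOffset (v : ℕ) where

      unitAt : ℕ → Bool
      unitAt t = c (v + t)

      removes : ℕ → ℕ → Bool
      removes m t = does (p ∣? (m * N + v + t))

      lift-unit : ∀ m t → c (m * N + v + t) ≡ unitAt t
      lift-unit m t = trans (cong c (trans (+-assoc (m * N) v t) (+-comm (m * N) (v + t)))) (periodic* m (v + t))

      removes-one-ordered : ∀ m t t′ → t < t′ → t′ < suc S → unitAt t ≡ true → unitAt t′ ≡ true →
        removes m t ≡ true → removes m t′ ≡ true → ⊥
      removes-one-ordered m t t′ t<t′ t′<R ut ut′ rt rt′ = <⇒≢ (m<n⇒0<n∸m t<t′) (sym d≡0)
        where
        x : ℕ
        x = m * N + v + t
        x+d : x + (t′ ∸ t) ≡ m * N + v + t′
        x+d = trans (+-assoc (m * N + v) t (t′ ∸ t)) (cong (m * N + v +_) (m+[n∸m]≡n (<⇒≤ t<t′)))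
        d≡0 : t′ ∸ t ≡ 0
        d≡0 = divisible-units-coincide x (t′ ∸ t) (trans (lift-unit m t) ut)
                (subst (λ z → c z ≡ true) (sym x+d) (trans (lift-unit m t′) ut′))
                (does-true⇒ (p ∣? x) rt) (subst (p ∣_) (sym x+d) (does-true⇒ (p ∣? _) rt′))
                (≤-<-trans (m∸n≤m t′ t) (≤-<-trans (≤-pred t′<R) short))

      removes-one : ∀ m t t′ → m < p → t < suc S → t′ < suc S → unitAt t ≡ true → unitAt t′ ≡ true →
        removes m t ≡ true → removes m t′ ≡ true → t ≡ t′
      removes-one m t t′ _ t<R t′<R ut ut′ rt rt′ with <-cmp t t′
      ... | tri< lt _ _ = ⊥-elim (removes-one-ordered m t t′ lt t′<R ut ut′ rt rt′)
      ... | tri≈ _ e _  = e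
      ... | tri> _ _ gt = ⊥-elim (removes-one-ordered m t′ t gt t<R ut′ ut rt′ rt)

      removed-once : ∀ t → t < suc S → count (λ m → removes m t) p ≡ 1
      removed-once t _ with residue-exists p N (v + t) (prime∤⇒coprime N pp p∤N)
      ... | m₀ , m₀<p , p∣ = count≡1 p _ m₀ m₀<p (dec-true (p ∣? _) (subst (p ∣_) (sym (+-assoc (m₀ * N) v t)) p∣))
            (λ i j i<p j<p ri rj → residue-unique p N (v + t) i j pp p∤N i<p j<p
               (subst (p ∣_) (+-assoc (i * N) v t) (does-true⇒ (p ∣? _) ri))
               (subst (p ∣_) (+-assoc (j * N) v t) (does-true⇒ (p ∣? _) rj)))

      open Removal p S required unitAt removes removes-one removed-once
                   (required-bounded s pos) (required-increasing s pos)

      survives≡lifted : ∀ j m → fromBool (c′ (m * N + v) ∧ drivesAt c′ s (m * N + v) j) ≡ survives j m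
      survives≡lifted j m = trans (drivesAt-window c′ s (m * N + v) j) (cong fromBool (cong₂ _∧_
          (all-cong required lifted) (cong (_≡ᵇ suc j) (sumBelow-cong (suc S) (λ t _ → cong fromBool (lifted t))))))
        where
        lifted : ∀ t → c′ (m * N + v + t) ≡ (unitAt t ∧ not (removes m t))
        lifted t = trans (c′-def _) (cong (_∧ not (removes m t)) (lift-unit m t))

      drives≡ : ∀ j → fromBool (allRequired ∧ (units ≡ᵇ suc j)) ≡ fromBool (c v ∧ drivesAt c s v j)
      drives≡ j = sym (drivesAt-window c s v j)

      count-lifts : ∀ j →
        sumBelow (λ m → fromBool (c′ (m * N + v) ∧ drivesAt c′ s (m * N + v) j)) p + fromBool (c v ∧ drivesAt c s v j) * suc j
          ≡ fromBool (c v ∧ drivesAt c s v j) * p + fromBool (c v ∧ drivesAt c s v (suc j)) * (suc j ∸ length s)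
      count-lifts j = begin
        sumBelow (λ m → fromBool (c′ (m * N + v) ∧ drivesAt c′ s (m * N + v) j)) p + fromBool (c v ∧ drivesAt c s v j) * suc j
          ≡⟨ cong₂ _+_ (sumBelow-cong p (λ m _ → survives≡lifted j m)) (cong (_* suc j) (sym (drives≡ j))) ⟩
        sumBelow (survives j) p + fromBool (allRequired ∧ (units ≡ᵇ suc j)) * suc j
          ≡⟨ count-survivors j ⟩
        fromBool (allRequired ∧ (units ≡ᵇ suc j)) * p
          + fromBool (allRequired ∧ (units ≡ᵇ suc (suc j))) * (suc (suc j) ∸ length required)
          ≡⟨ cong₂ _+_ (cong (_* p) (drives≡ j))
                       (cong₂ _*_ (drives≡ (suc j)) (cong (λ z → suc (suc j) ∸ suc z) (length-partialSums s))) ⟩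
        fromBool (c v ∧ drivesAt c s v j) * p + fromBool (c v ∧ drivesAt c s v (suc j)) * (suc j ∸ length s) ∎
        where open ≡-Reasoning

    periodCount-lift : ∀ j → periodCount c′ (p * N) s j + suc j * periodCount c N s j
                           ≡ p * periodCount c N s j + (suc j ∸ length s) * periodCount c N s (suc j)
    periodCount-lift j = begin
      periodCount c′ (p * N) s j + suc j * periodCount c N s j
        ≡⟨ cong (_+ suc j * periodCount c N s j)
                (trans (sumBelow-blocks p N lifted) (sumBelow-swap p N (λ m v → lifted (m * N + v)))) ⟩
      sumBelow (λ v → sumBelow (λ m → lifted (m * N + v)) p) N + suc j * periodCount c N s j
        ≡⟨ cong (sumBelow (λ v → sumBelow (λ m → lifted (m * N + v)) p) N +_)
                (trans (sym (sumBelow-*ˡ N (suc j) drives)) (sumBelow-cong N (λ v _ → *-comm (suc j) (drives v)))) ⟩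
      sumBelow (λ v → sumBelow (λ m → lifted (m * N + v)) p) N + sumBelow (λ v → drives v * suc j) N
        ≡⟨ sym (sumBelow-distrib-+ N _ _) ⟩
      sumBelow (λ v → sumBelow (λ m → lifted (m * N + v)) p + drives v * suc j) N
        ≡⟨ sumBelow-cong N (λ v _ → AtOffset.count-lifts v j) ⟩
      sumBelow (λ v → drives v * p + drives′ v * (suc j ∸ length s)) N
        ≡⟨ sumBelow-distrib-+ N _ _ ⟩
      sumBelow (λ v → drives v * p) N + sumBelow (λ v → drives′ v * (suc j ∸ length s)) N
        ≡⟨ cong₂ _+_ (trans (sumBelow-cong N (λ v _ → *-comm (drives v) p)) (sumBelow-*ˡ N p drives))
                     (trans (sumBelow-cong N (λ v _ → *-comm (drives′ v) _)) (sumBelow-*ˡ N (suc j ∸ length s) drives′)) ⟩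
      p * periodCount c N s j + (suc j ∸ length s) * periodCount c N s (suc j) ∎
      where
      open ≡-Reasoning
      lifted : ℕ → ℕ
      lifted u = fromBool (c′ u ∧ drivesAt c′ s u j)
      drives : ℕ → ℕ
      drives v = fromBool (c v ∧ drivesAt c s v j)
      drives′ : ℕ → ℕ
      drives′ v = fromBool (c v ∧ drivesAt c s v (suc j))

module Primorials where

  open import Data.Nat
  open import Data.Nat.Properties
  open import Data.Nat.Divisibility
  open import Data.Nat.Primality
  open import Data.Nat.Primality.Factorisation using (factorise)
  open import Data.Nat.ListAction using (product)

  prime⇒1< : ∀ {p} → Prime p → 1 < p
  prime⇒1< {p} pp = nonTrivial⇒n>1 p {{prime⇒nonTrivial pp}}

  1≤primorial : ∀ n → 1 ≤ primorial n
  1≤primorial zero    = ≤-refl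
  1≤primorial (suc n) with prime? (suc n)
  ... | yes _ = ≤-trans (1≤primorial n) (m≤n*m (primorial n) (suc n))
  ... | no  _ = 1≤primorial n

  prime∣primorial⇒≤ : ∀ n P → Prime P → P ∣ primorial n → P ≤ n
  prime∣primorial⇒≤ zero    P pp h = ⊥-elim (¬prime[1] (subst Prime (∣1⇒≡1 h) pp))
  prime∣primorial⇒≤ (suc n) P pp h with prime? (suc n)
  ... | no  _ = m≤n⇒m≤1+n (prime∣primorial⇒≤ n P pp h)
  ... | yes _ with euclidsLemma (suc n) (primorial n) pp h
  ... | inj₁ P∣n = ∣⇒≤ P∣n
  ... | inj₂ P∣# = m≤n⇒m≤1+n (prime∣primorial⇒≤ n P pp P∣#)

  primorial∣primorial-suc : ∀ n → primorial n ∣ primorial (suc n)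
  primorial∣primorial-suc n with prime? (suc n)
  ... | yes _ = n∣m*n (suc n)
  ... | no  _ = ∣-refl

  primorial-∣ : ∀ {m} n → m ≤ n → primorial m ∣ primorial n
  primorial-∣ zero    z≤n = ∣-refl
  primorial-∣ (suc n) m≤1+n with m≤n⇒m<n∨m≡n m≤1+n
  ... | inj₂ refl      = ∣-refl
  ... | inj₁ (s≤s m≤n) = ∣-trans (primorial-∣ n m≤n) (primorial∣primorial-suc n)

  2∣primorial : ∀ n → 2 ≤ n → 2 ∣ primorial n
  2∣primorial n 2≤n = ∣-trans (divides 1 refl) (primorial-∣ n 2≤n)

  primorial-skip : ∀ q d → (∀ i → i < d → ¬ Prime (suc q + i)) → primorial (q + d) ≡ primorial q
  primorial-skip q zero    h = cong primorial (+-identityʳ q)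
  primorial-skip q (suc d) h rewrite +-suc q d with prime? (suc (q + d))
  ... | yes pr = ⊥-elim (h d ≤-refl pr)
  ... | no  _  = primorial-skip q d (λ i i<d → h i (m≤n⇒m≤1+n i<d))

  primorial-next : ∀ q i → Prime (suc q + i) → (∀ j → j < i → ¬ Prime (suc q + j)) →
    primorial (suc q + i) ≡ (suc q + i) * primorial q
  primorial-next q i pr h with prime? (suc (q + i))
  ... | no  np = ⊥-elim (np pr)
  ... | yes _  = cong (suc (q + i) *_) (primorial-skip q i h)

  firstOr-filter-prime : ∀ n (f : ℕ → ℕ) → (Σ ℕ λ i → i < n × Prime (f i)) →
    Σ ℕ λ i₀ → firstOr 0 (filter prime? (applyUpTo f n)) ≡ f i₀ × Prime (f i₀) × (∀ i → i < i₀ → ¬ Prime (f i))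
  firstOr-filter-prime (suc n) f w with prime? (f 0)
  ... | yes pr = 0 , refl , pr , (λ i ())
  ... | no np with w
  ... | zero  , _         , pr = ⊥-elim (np pr)
  ... | suc i , s<s i<n , pr with firstOr-filter-prime n (λ i → f (suc i)) (i , i<n , pr)
  ... | i₀ , first≡ , pr₀ , before = suc i₀ , first≡ , pr₀ , before′
    where
    before′ : ∀ i → i < suc i₀ → ¬ Prime (f i)
    before′ zero    _          = np
    before′ (suc i) (s<s i<i₀) = before i i<i₀

  ∣! : ∀ q k → 1 ≤ k → k ≤ q → k ∣ q !
  ∣! zero    (suc k) _   ()
  ∣! (suc q) k 1≤k k≤sq with m≤n⇒m<n∨m≡n k≤sq
  ... | inj₂ refl      = m∣m*n (q !)
  ... | inj₁ (s≤s k≤q) = ∣n⇒∣m*n (suc q) (∣! q k 1≤k k≤q)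

  -- Euclid: every prime factor of q! + 1 exceeds q.
  prime-after : ∀ q → 1 ≤ q → Σ ℕ λ i → i < q ! × Prime (suc q + i)
  prime-after q 1≤q with factorise (q ! + 1) {{q!+1-nonZero}}
    where
    q!+1-nonZero : NonZero (q ! + 1)
    q!+1-nonZero = subst NonZero (+-comm 1 (q !)) _
  ... | record { factors = [] ; isFactorisation = eq } =
    ⊥-elim (<-irrefl (sym eq) (subst (1 <_) (+-comm 1 (q !)) (s≤s (1≤n! q))))
  ... | record { factors = P ∷ rest ; isFactorisation = eq ; factorsPrime = pP ∷ _ } =
    P ∸ suc q , i<q! , subst Prime (sym (m+[n∸m]≡n q<P)) pP
    where
    P∣ : P ∣ q ! + 1
    P∣ = subst (P ∣_) (sym eq) (m∣m*n (product rest))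
    q<P : q < P
    q<P with q <? P
    ... | yes lt  = lt
    ... | no  nlt = ⊥-elim (¬prime[1] (subst Prime (∣1⇒≡1 (∣m+n∣m⇒∣n P∣ (∣! q P (<⇒≤ (prime⇒1< pP)) (≮⇒≥ nlt)))) pP))
    q≤q! : ∀ q → q ≤ q !
    q≤q! zero    = z≤n
    q≤q! (suc q) = m≤m*n (suc q) (q !) {{q !≢0}}
    i<q! : P ∸ suc q < q !
    i<q! = ≤-<-trans (∸-monoˡ-≤ (suc q) (∣⇒≤ {{subst NonZero (+-comm 1 (q !)) _}} P∣))
             (subst (_< q !) (sym (cong (_∸ suc q) (+-comm (q !) 1))) (∸-monoʳ-< {q !} {q} {0} 1≤q (q≤q! q)))

  nextPrime-spec : ∀ q → 1 ≤ q →
    Σ ℕ λ i → nextPrime q ≡ suc q + i × Prime (suc q + i) × (∀ j → j < i → ¬ Prime (suc q + j))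
  nextPrime-spec q 1≤q = firstOr-filter-prime (q !) (λ i → suc q + i) (prime-after q 1≤q)

  nextPrime-prime : ∀ q → 1 ≤ q → Prime (nextPrime q)
  nextPrime-prime q 1≤q with nextPrime-spec q 1≤q
  ... | i , next≡ , pr , _ = subst Prime (sym next≡) pr

  <nextPrime : ∀ q → 1 ≤ q → q < nextPrime q
  <nextPrime q 1≤q with nextPrime-spec q 1≤q
  ... | i , next≡ , _ , _ = subst (q <_) (sym next≡) (s≤s (m≤m+n q i))

  primorial-nextPrime : ∀ q → 1 ≤ q → primorial (nextPrime q) ≡ nextPrime q * primorial q
  primorial-nextPrime q 1≤q with nextPrime-spec q 1≤q
  ... | i , next≡ , pr , before rewrite next≡ = primorial-next q i pr before

  nextPrime∤primorial : ∀ q → 1 ≤ q → ¬ nextPrime q ∣ primorial q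
  nextPrime∤primorial q 1≤q d = <⇒≱ (<nextPrime q 1≤q) (prime∣primorial⇒≤ q (nextPrime q) (nextPrime-prime q 1≤q) d)

  primeSeq-prime : ∀ p₀ → Prime p₀ → ∀ k → Prime (primeSeq p₀ k)
  primeSeq-prime p₀ pp zero    = pp
  primeSeq-prime p₀ pp (suc k) = nextPrime-prime _ (<⇒≤ (prime⇒1< (primeSeq-prime p₀ pp k)))

  primeSeq-mono : ∀ p₀ → Prime p₀ → ∀ k → primeSeq p₀ 1 ≤ primeSeq p₀ (suc k)
  primeSeq-mono p₀ pp zero    = ≤-refl
  primeSeq-mono p₀ pp (suc k) = ≤-trans (primeSeq-mono p₀ pp k)
    (<⇒≤ (<nextPrime _ (<⇒≤ (prime⇒1< (primeSeq-prime p₀ pp (suc k))))))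

module DrivingTerms where

  open import Data.Nat
  open import Data.Nat.Properties
  open import Data.Nat.Divisibility
  open import Data.Nat.Primality
  open import Data.Nat.Coprimality using (Coprime; coprime?; coprime-divisor)
  open import Data.Nat.ListAction using (sum)
  open ListFacts using (filter≡filterᵇ)
  open GapCycle using (periodCount; module Periodic)
  open Residues using (prime∤⇒coprime)
  open Primorials
  open Lifting using (module Lift)

  unit? : ℕ → ℕ → Bool
  unit? M u = does (coprime? u M)

  unit?-periodic : ∀ M x → unit? M (x + M) ≡ unit? M x
  unit?-periodic M x = does-cong (coprime? (x + M) M) (coprime? x M)
    (λ h {d} (d∣x , d∣M) → h (∣m∣n⇒∣m+n d∣x d∣M , d∣M))
    (λ h {d} (d∣x+M , d∣M) → h (∣m+n∣m⇒∣n (subst (d ∣_) (+-comm x M) d∣x+M) d∣M , d∣M))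

  unit?-1 : ∀ M → unit? M 1 ≡ true
  unit?-1 M = dec-true (coprime? 1 M) (λ (d∣1 , _) → ∣1⇒≡1 d∣1)

  unit?-odd : ∀ M x → 2 ∣ M → unit? M x ≡ true → ¬ 2 ∣ x
  unit?-odd M x 2∣M h 2∣x with does-true⇒ (coprime? x M) h (2∣x , 2∣M)
  ... | ()

  unit?-* : ∀ p N x → Prime p → unit? (p * N) x ≡ unit? N x ∧ not (does (p ∣? x))
  unit?-* p N x pp = by-cases (coprime? x N) (p ∣? x)
    where
    by-cases : (cop? : Dec (Coprime x N)) (p∣x? : Dec (p ∣ x)) → unit? (p * N) x ≡ does cop? ∧ not (does p∣x?)
    by-cases (no ¬cop) _ = dec-false (coprime? x (p * N)) (λ h → ¬cop (λ (d∣x , d∣N) → h (d∣x , ∣n⇒∣m*n p d∣N)))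
    by-cases (yes cop) (yes p∣x) = dec-false (coprime? x (p * N)) (λ h → ¬prime[1] (subst Prime (h (p∣x , m∣m*n N)) pp))
    by-cases (yes cop) (no p∤x) = dec-true (coprime? x (p * N)) (λ {d} (d∣x , d∣pN) →
      cop (d∣x , coprime-divisor (prime∤⇒coprime d pp (λ p∣d → p∤x (∣-trans p∣d d∣x))) d∣pN))

  drivingCount≡periodCount : ∀ M → .{{_ : NonZero M}} → ∀ s → All (0 <_) s → ∀ j →
    drivingCount s j M ≡ periodCount (unit? M) M s j
  drivingCount≡periodCount M s pos j =
    trans (cong (λ g → length (filterᵇ (λ i → splits s (window g i j)) (upTo (length g))))
                (cong diffs (filter≡filterᵇ (λ u → coprime? u M) (applyUpTo suc (suc M)))))
          (count-drivingTerms s pos j)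
    where open Periodic.Units (unit? M) M (unit?-periodic M) (unit?-1 M)

  drivingCount-nextPrime : ∀ q → Prime q → ∀ s → All (0 <_) s → sum s < 2 * nextPrime q → ∀ j →
    drivingCount s j (primorial (nextPrime q)) + suc j * drivingCount s j (primorial q)
      ≡ nextPrime q * drivingCount s j (primorial q) + (suc j ∸ length s) * drivingCount s (suc j) (primorial q)
  drivingCount-nextPrime q pq s pos short j = begin
    drivingCount s j (primorial p) + suc j * drivingCount s j N
      ≡⟨ cong₂ (λ a b → a + suc j * b)
               (trans (cong (drivingCount s j) (primorial-nextPrime q 1≤q)) (drivingCount≡periodCount (p * N) s pos j))
               (drivingCount≡periodCount N s pos j) ⟩
    periodCount (unit? (p * N)) (p * N) s j + suc j * periodCount (unit? N) N s j
      ≡⟨ periodCount-lift j ⟩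
    p * periodCount (unit? N) N s j + (suc j ∸ length s) * periodCount (unit? N) N s (suc j)
      ≡⟨ sym (cong₂ (λ a b → p * a + (suc j ∸ length s) * b)
                    (drivingCount≡periodCount N s pos j) (drivingCount≡periodCount N s pos (suc j))) ⟩
    p * drivingCount s j N + (suc j ∸ length s) * drivingCount s (suc j) N ∎
    where
    open ≡-Reasoning
    p : ℕ
    p = nextPrime q
    N : ℕ
    N = primorial q
    1≤q : 1 ≤ q
    1≤q = <⇒≤ (prime⇒1< pq)
    pp : Prime p
    pp = nextPrime-prime q 1≤q
    instance
      N-nonZero : NonZero N
      N-nonZero = >-nonZero (1≤primorial q)
      p-nonZero : NonZero p
      p-nonZero = prime⇒nonZero pp
      pN-nonZero : NonZero (p * N)
      pN-nonZero = m*n≢0 p N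
    p-odd : ¬ 2 ∣ p
    p-odd 2∣p with prime⇒irreducible pp 2∣p
    ... | inj₁ ()
    ... | inj₂ 2≡p = <⇒≱ (≤-<-trans (prime⇒1< pq) (<nextPrime q 1≤q)) (≤-reflexive (sym 2≡p))
    open Lift N p (unit? N) (unit? (p * N)) (unit?-periodic N) (λ x → unit?-* p N x pp)
              (λ x → unit?-odd N x (2∣primorial q (prime⇒1< pq))) pp p-odd (nextPrime∤primorial q 1≤q) s pos short

module BinomialMatrices where

  open import Data.Nat as ℕ using (_<_; _≤_; z≤n; s≤s; _∸_; _≤ᵇ_)
  import Data.Nat.Properties as ℕₚ
  open import Data.Nat.Combinatorics using (_C_; k>n⇒nCk≡0; nC1≡n; nCk+nC[k+1]≡[n+1]C[k+1])
  import Data.Nat.Tactic.RingSolver as ℕ-Solver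
  open import Data.Integer using (ℤ; +_; -_; _+_; _*_; _-_)
  open import Data.Integer.Properties
  open import Data.Integer.Tactic.RingSolver using (solve-∀)
  open import Data.Fin as Fin using (Fin; toℕ)
  open import Data.Fin.Properties using (toℕ<n)

  pascal : ∀ n k → ℕ.suc n C ℕ.suc k ≡ n C k ℕ.+ n C ℕ.suc k
  pascal n k = sym (nCk+nC[k+1]≡[n+1]C[k+1] n k)

  n*nCk≡k*nCk+[k+1]*nC[k+1] : ∀ n k → n ℕ.* (n C k) ≡ k ℕ.* (n C k) ℕ.+ suc k ℕ.* (n C suc k)
  n*nCk≡k*nCk+[k+1]*nC[k+1] zero    zero    = refl
  n*nCk≡k*nCk+[k+1]*nC[k+1] zero    (suc k) = sym (cong₂ ℕ._+_ (ℕₚ.*-zeroʳ (suc k)) (ℕₚ.*-zeroʳ (suc (suc k))))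
  n*nCk≡k*nCk+[k+1]*nC[k+1] (suc n) zero    = trans (ℕₚ.*-identityʳ (suc n)) (sym (trans (ℕₚ.+-identityʳ _) (nC1≡n (suc n))))
  n*nCk≡k*nCk+[k+1]*nC[k+1] (suc n) (suc k) rewrite pascal n k | pascal n (suc k) =
    trans (expand n (n C k) (n C suc k))
      (trans (cong₂ (λ u v → (n C k ℕ.+ n C suc k) ℕ.+ (u ℕ.+ v))
                    (n*nCk≡k*nCk+[k+1]*nC[k+1] n k) (n*nCk≡k*nCk+[k+1]*nC[k+1] n (suc k)))
             (collect k (n C k) (n C suc k) (n C suc (suc k))))
    where
    expand : ∀ n x y → suc n ℕ.* (x ℕ.+ y) ≡ (x ℕ.+ y) ℕ.+ (n ℕ.* x ℕ.+ n ℕ.* y)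
    expand = ℕ-Solver.solve-∀
    collect : ∀ k x y z → (x ℕ.+ y) ℕ.+ ((k ℕ.* x ℕ.+ suc k ℕ.* y) ℕ.+ (suc k ℕ.* y ℕ.+ suc (suc k) ℕ.* z))
                        ≡ suc k ℕ.* (x ℕ.+ y) ℕ.+ suc (suc k) ℕ.* (y ℕ.+ z)
    collect = ℕ-Solver.solve-∀

  sumℤ : (ℕ → ℤ) → ℕ → ℤ
  sumℤ F zero    = + 0
  sumℤ F (suc n) = F 0 + sumℤ (λ i → F (suc i)) n

  sumℤ-cong : ∀ n {F G : ℕ → ℤ} → (∀ i → F i ≡ G i) → sumℤ F n ≡ sumℤ G n
  sumℤ-cong zero    h = refl
  sumℤ-cong (suc n) h = cong₂ _+_ (h 0) (sumℤ-cong n (λ i → h (suc i)))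

  sumℤ-distrib-+ : ∀ n (F G : ℕ → ℤ) → sumℤ (λ i → F i + G i) n ≡ sumℤ F n + sumℤ G n
  sumℤ-distrib-+ zero    F G = refl
  sumℤ-distrib-+ (suc n) F G = trans (cong (λ z → (F 0 + G 0) + z) (sumℤ-distrib-+ n _ _)) (interchange (F 0) (G 0) _ _)
    where
    interchange : ∀ a b c d → (a + b) + (c + d) ≡ (a + c) + (b + d)
    interchange = solve-∀

  sumℤ-*ˡ : ∀ n k (F : ℕ → ℤ) → sumℤ (λ i → k * F i) n ≡ k * sumℤ F n
  sumℤ-*ˡ zero    k F = sym (*-zeroʳ k)
  sumℤ-*ˡ (suc n) k F = trans (cong (λ z → k * F 0 + z) (sumℤ-*ˡ n k _)) (sym (*-distribˡ-+ k (F 0) _))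

  sumℤ-neg : ∀ n (F : ℕ → ℤ) → sumℤ (λ i → - F i) n ≡ - sumℤ F n
  sumℤ-neg zero    F = refl
  sumℤ-neg (suc n) F = trans (cong (λ z → - F 0 + z) (sumℤ-neg n _)) (sym (neg-distrib-+ (F 0) _))

  sumℤ-suc : ∀ n (F : ℕ → ℤ) → sumℤ F (suc n) ≡ sumℤ F n + F n
  sumℤ-suc zero    F = +-comm (F 0) (+ 0)
  sumℤ-suc (suc n) F = trans (cong (λ z → F 0 + z) (sumℤ-suc n _)) (sym (+-assoc (F 0) _ _))

  sumℤ-zero : ∀ n (F : ℕ → ℤ) → (∀ i → F i ≡ + 0) → sumℤ F n ≡ + 0
  sumℤ-zero zero    F h = refl
  sumℤ-zero (suc n) F h = cong₂ _+_ (h 0) (sumℤ-zero n _ (λ i → h (suc i)))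

  sumℤ-single : ∀ n (F : ℕ → ℤ) k → k < n → (∀ i → i ≢ k → F i ≡ + 0) → sumℤ F n ≡ F k
  sumℤ-single (suc n) F zero    _         h =
    trans (cong (λ z → F 0 + z) (sumℤ-zero n _ (λ i → h (suc i) (λ ())))) (+-identityʳ _)
  sumℤ-single (suc n) F (suc k) (s≤s k<n) h =
    trans (cong (_+ sumℤ (λ i → F (suc i)) n) (h 0 (λ ())))
      (trans (+-identityˡ _) (sumℤ-single n (λ i → F (suc i)) k k<n (λ i i≢k → h (suc i) (λ e → i≢k (ℕₚ.suc-injective e)))))

  sumℤ-pair : ∀ n (F : ℕ → ℤ) k → suc k < n → (∀ i → i ≢ k → i ≢ suc k → F i ≡ + 0) → sumℤ F n ≡ F k + F (suc k)
  sumℤ-pair (suc n) F zero    (s≤s 1<n) h =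
    cong (λ z → F 0 + z) (sumℤ-single n (λ i → F (suc i)) 0 1<n (λ i i≢0 → h (suc i) (λ ()) (λ e → i≢0 (ℕₚ.suc-injective e))))
  sumℤ-pair (suc n) F (suc k) (s≤s k<n) h =
    trans (cong (_+ sumℤ (λ i → F (suc i)) n) (h 0 (λ ()) (λ ())))
      (trans (+-identityˡ _) (sumℤ-pair n (λ i → F (suc i)) k k<n
        (λ i i≢k i≢k+1 → h (suc i) (λ e → i≢k (ℕₚ.suc-injective e)) (λ e → i≢k+1 (ℕₚ.suc-injective e)))))

  sumFin≡sumℤ : ∀ m (F : ℕ → ℤ) → sumFin {m} (λ c → F (toℕ c)) ≡ sumℤ F m
  sumFin≡sumℤ zero    F = refl
  sumFin≡sumℤ (suc m) F = cong (λ z → F 0 + z) (sumFin≡sumℤ m (λ i → F (suc i)))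

  sumFin-cong : ∀ m {F G : Fin m → ℤ} → (∀ c → F c ≡ G c) → sumFin F ≡ sumFin G
  sumFin-cong zero    h = refl
  sumFin-cong (suc m) h = cong₂ _+_ (h Fin.zero) (sumFin-cong m (λ c → h (Fin.suc c)))

  sign : ℕ → ℤ
  sign zero    = + 1
  sign (suc k) = - sign k

  signℤ≡sign : ∀ k → signℤ k ≡ sign k
  signℤ≡sign zero          = refl
  signℤ≡sign (suc zero)    = refl
  signℤ≡sign (suc (suc k)) = trans (signℤ≡sign k) (sym (neg-involutive (sign k)))

  sign-+ : ∀ x y → sign (x ℕ.+ y) ≡ sign x * sign y
  sign-+ zero    y = sym (*-identityˡ (sign y))
  sign-+ (suc x) y = trans (cong -_ (sign-+ x y)) (neg-distribˡ-* (sign x) (sign y))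

  sign*sign : ∀ x → sign x * sign x ≡ + 1
  sign*sign zero    = refl
  sign*sign (suc x) = trans (sym (neg-distribˡ-* (sign x) (- sign x)))
    (trans (cong -_ (sym (neg-distribʳ-* (sign x) (sign x)))) (trans (neg-involutive _) (sign*sign x)))

  sign-via : ∀ x b c → sign (x ℕ.+ c) ≡ sign (x ℕ.+ b) * sign (b ℕ.+ c)
  sign-via x b c = sym (begin
    sign (x ℕ.+ b) * sign (b ℕ.+ c)   ≡⟨ cong₂ _*_ (sign-+ x b) (sign-+ b c) ⟩
    (sign x * sign b) * (sign b * sign c) ≡⟨ regroup (sign x) (sign b) (sign c) ⟩
    sign x * (sign b * sign b) * sign c ≡⟨ cong (λ z → sign x * z * sign c) (sign*sign b) ⟩
    sign x * + 1 * sign c             ≡⟨ cong (_* sign c) (*-identityʳ (sign x)) ⟩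
    sign x * sign c                   ≡⟨ sym (sign-+ x c) ⟩
    sign (x ℕ.+ c)                    ∎)
    where
    open ≡-Reasoning
    regroup : ∀ x b c → (x * b) * (b * c) ≡ x * (b * b) * c
    regroup = solve-∀

  binom : ℕ → ℕ → ℤ
  binom n k = + (n C k)

  δ : ℕ → ℕ → ℤ
  δ a b = if a ≡ᵇ b then + 1 else + 0

  sign*δ : ∀ x b → sign (x ℕ.+ b) * δ x b ≡ δ x b
  sign*δ x b with x ≡ᵇ b in x≡ᵇb
  ... | false = *-zeroʳ (sign (x ℕ.+ b))
  ... | true rewrite ≡ᵇ-true⇒≡ x b x≡ᵇb = trans (*-identityʳ _) (trans (sign-+ b b) (sign*sign b))

  alternatingSum : ℕ → ℕ → ℕ → ℤ
  alternatingSum n b a = sumℤ (λ c → sign (b ℕ.+ c) * (binom b c * binom c a)) n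

  alternatingSum-suc : ∀ n b a → b < n → alternatingSum (suc n) b a ≡ alternatingSum n b a
  alternatingSum-suc n b a b<n = trans (sumℤ-suc n _)
    (trans (cong (λ z → alternatingSum n b a + sign (b ℕ.+ n) * (+ z * binom n a)) (k>n⇒nCk≡0 b<n))
      (trans (cong (λ z → alternatingSum n b a + z) (*-zeroʳ (sign (b ℕ.+ n)))) (+-identityʳ _)))

  alternatingSum-pascal-lower : ∀ n b a →
    sumℤ (λ c → sign (b ℕ.+ c) * (binom b c * binom (suc c) (suc a))) n ≡ alternatingSum n b a + alternatingSum n b (suc a)
  alternatingSum-pascal-lower n b a =
    trans (sumℤ-cong n (λ c → trans (cong (λ z → sign (b ℕ.+ c) * (binom b c * z)) (cong +_ (pascal c a)))
                                    (distrib (sign (b ℕ.+ c)) (binom b c) (binom c a) (binom c (suc a)))))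
          (sumℤ-distrib-+ n _ _)
    where
    distrib : ∀ s x y z → s * (x * (y + z)) ≡ s * (x * y) + s * (x * z)
    distrib = solve-∀

  sign-b+0 : ∀ b → sign (b ℕ.+ 0) ≡ sign b
  sign-b+0 b = cong sign (ℕₚ.+-identityʳ b)

  alternatingSum-pascal-upper : ∀ n b a → alternatingSum (suc n) (suc b) a
    ≡ - (sign b * binom 0 a) + (sumℤ (λ c → sign (b ℕ.+ c) * (binom b c * binom (suc c) a)) n
                                + sumℤ (λ c → sign (b ℕ.+ c) * (binom b (suc c) * binom (suc c) a)) n)
  alternatingSum-pascal-upper n b a = cong₂ _+_
    (trans (cong (λ z → - z * (+ 1 * binom 0 a)) (sign-b+0 b)) (neg-unit-left (sign b) (binom 0 a)))
    (trans (sumℤ-cong n (λ c → trans (cong₂ (λ u v → u * (v * binom (suc c) a)) (sign-shift c) (cong +_ (pascal b c)))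
                                     (distrib (sign (b ℕ.+ c)) (binom b c) (binom b (suc c)) (binom (suc c) a))))
           (sumℤ-distrib-+ n _ _))
    where
    neg-unit-left : ∀ s x → - s * (+ 1 * x) ≡ - (s * x)
    neg-unit-left = solve-∀
    distrib : ∀ s x y z → s * ((x + y) * z) ≡ s * (x * z) + s * (y * z)
    distrib = solve-∀
    sign-shift : ∀ c → sign (suc b ℕ.+ suc c) ≡ sign (b ℕ.+ c)
    sign-shift c = trans (cong (λ z → - sign z) (ℕₚ.+-suc b c)) (neg-involutive _)

  alternatingSum-suc-first : ∀ n b a → alternatingSum (suc n) b a
    ≡ sign b * binom 0 a + - sumℤ (λ c → sign (b ℕ.+ c) * (binom b (suc c) * binom (suc c) a)) n
  alternatingSum-suc-first n b a = cong₂ _+_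
    (trans (cong (λ z → z * (binom b 0 * binom 0 a)) (sign-b+0 b)) (unit-left (sign b) (binom 0 a)))
    (trans (sumℤ-cong n (λ c → trans (cong (λ z → z * (binom b (suc c) * binom (suc c) a)) (cong sign (ℕₚ.+-suc b c)))
                                     (sym (neg-distribˡ-* (sign (b ℕ.+ c)) (binom b (suc c) * binom (suc c) a)))))
           (sumℤ-neg n _))
    where
    unit-left : ∀ s x → s * (+ 1 * x) ≡ s * x
    unit-left = solve-∀

  -- Binomial inversion, by Pascal's rule in both b and a.
  alternatingSum≡δ : ∀ b n a → b < n → alternatingSum n b a ≡ δ a b
  alternatingSum≡δ zero (suc n) a _ =
    trans (cong₂ _+_ (head a) (sumℤ-zero n _ (λ i → *-zeroʳ (sign (suc i))))) (+-identityʳ _)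
    where
    head : ∀ a → sign 0 * (binom 0 0 * binom 0 a) ≡ δ a 0
    head zero    = refl
    head (suc a) = refl
  alternatingSum≡δ (suc b) (suc n) a (s≤s b<n) = begin
    alternatingSum (suc n) (suc b) a        ≡⟨ alternatingSum-pascal-upper n b a ⟩
    - K + (X + Y)                           ≡⟨ rearrange K X Y ⟩
    X - (K + - Y)                           ≡⟨ cong (λ z → X - z) (sym (alternatingSum-suc-first n b a)) ⟩
    X - alternatingSum (suc n) b a          ≡⟨ cong (λ z → X - z) (alternatingSum-suc n b a b<n) ⟩
    X - alternatingSum n b a                ≡⟨ pascal-lower a ⟩
    δ a (suc b)                             ∎
    where
    open ≡-Reasoning
    K : ℤ
    K = sign b * binom 0 a
    X : ℤ
    X = sumℤ (λ c → sign (b ℕ.+ c) * (binom b c * binom (suc c) a)) n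
    Y : ℤ
    Y = sumℤ (λ c → sign (b ℕ.+ c) * (binom b (suc c) * binom (suc c) a)) n
    rearrange : ∀ K x y → - K + (x + y) ≡ x - (K + - y)
    rearrange = solve-∀
    cancel : ∀ x y → (x + y) - y ≡ x
    cancel = solve-∀
    pascal-lower : ∀ a → sumℤ (λ c → sign (b ℕ.+ c) * (binom b c * binom (suc c) a)) n - alternatingSum n b a ≡ δ a (suc b)
    pascal-lower zero    = +-inverseʳ (alternatingSum n b 0)
    pascal-lower (suc a) =
      trans (cong (_- alternatingSum n b (suc a)) (alternatingSum-pascal-lower n b a))
            (trans (cancel (alternatingSum n b a) (alternatingSum n b (suc a))) (alternatingSum≡δ b n a b<n))

  alternatingSum′≡δ : ∀ m b → b < m → ∀ x → sumℤ (λ c → sign (x ℕ.+ c) * (binom c x * binom b c)) m ≡ δ x b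
  alternatingSum′≡δ m b b<m x =
    trans (sumℤ-cong m (λ c → trans (cong (λ z → z * (binom c x * binom b c)) (sign-via x b c))
                                    (regroup (sign (x ℕ.+ b)) (sign (b ℕ.+ c)) (binom c x) (binom b c))))
      (trans (sumℤ-*ˡ m (sign (x ℕ.+ b)) _) (trans (cong (sign (x ℕ.+ b) *_) (alternatingSum≡δ b m x b<m)) (sign*δ x b)))
    where
    regroup : ∀ s t x y → (s * t) * (x * y) ≡ s * (t * (y * x))
    regroup = solve-∀

  Lmat-entry : ∀ x y → (if x ≤ᵇ y then + (y C x) else + 0) ≡ binom y x
  Lmat-entry x y with x ≤ᵇ y
  ... | true  = refl
  ... | false = refl

  Rmat-entry : ∀ x y → (if x ≤ᵇ y then signℤ (x ℕ.+ y) * + (y C x) else + 0) ≡ sign (x ℕ.+ y) * binom y x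
  Rmat-entry x y = if-sign (x ≤ᵇ y) binom≡0
    where
    binom≡0 : (x ≤ᵇ y) ≡ false → binom y x ≡ + 0
    binom≡0 x≰y rewrite x≰y = refl
    if-sign : ∀ b → (b ≡ false → binom y x ≡ + 0) →
      (if b then signℤ (x ℕ.+ y) * binom y x else + 0) ≡ sign (x ℕ.+ y) * binom y x
    if-sign true  _ = cong (_* binom y x) (signℤ≡sign (x ℕ.+ y))
    if-sign false h = sym (trans (cong (sign (x ℕ.+ y) *_) (h refl)) (*-zeroʳ (sign (x ℕ.+ y))))

  Lmat⊗Rmat≡identity : ∀ m (a b : Fin m) → (Lmat ⊗ Rmat) a b ≡ identity a b
  Lmat⊗Rmat≡identity m a b = begin
    sumFin {m} (λ c → Lmat a c * Rmat c b)
      ≡⟨ sumFin-cong m (λ c → cong₂ _*_ (Lmat-entry (toℕ a) (toℕ c)) (Rmat-entry (toℕ c) (toℕ b))) ⟩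
    sumFin {m} (λ c → binom (toℕ c) (toℕ a) * (sign (toℕ c ℕ.+ toℕ b) * binom (toℕ b) (toℕ c)))
      ≡⟨ sumFin≡sumℤ m (λ c → binom c (toℕ a) * (sign (c ℕ.+ toℕ b) * binom (toℕ b) c)) ⟩
    sumℤ (λ c → binom c (toℕ a) * (sign (c ℕ.+ toℕ b) * binom (toℕ b) c)) m
      ≡⟨ sumℤ-cong m (λ c → trans (cong (λ z → binom c (toℕ a) * (sign z * binom (toℕ b) c)) (ℕₚ.+-comm c (toℕ b)))
                                  (rotate (binom c (toℕ a)) (sign (toℕ b ℕ.+ c)) (binom (toℕ b) c))) ⟩
    alternatingSum m (toℕ b) (toℕ a)
      ≡⟨ alternatingSum≡δ (toℕ b) m (toℕ a) (toℕ<n b) ⟩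
    identity a b ∎
    where
    open ≡-Reasoning
    rotate : ∀ x s y → x * (s * y) ≡ s * (y * x)
    rotate = solve-∀

  module _ (m b : ℕ) (b<m : b < m) (λ₀ : ℤ) where

    -- Expanding c = a C(c,a) + (a+1) C(c,a+1) splits the sum into two binomial inversions.
    RΛL-entry : ∀ a → sumℤ (λ c → sign (a ℕ.+ c) * binom c a * ((λ₀ - + c) * binom b c)) m
                      ≡ λ₀ * δ a b - + a * δ a b + + suc a * δ (suc a) b
    RΛL-entry a = begin
      sumℤ (λ c → sign (a ℕ.+ c) * binom c a * ((λ₀ - + c) * binom b c)) m
        ≡⟨ sumℤ-cong m term ⟩
      sumℤ (λ c → (λ₀ * E c + - (+ a * E c)) + + suc a * E′ c) m
        ≡⟨ trans (sumℤ-distrib-+ m _ _)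
                 (cong₂ _+_ (trans (sumℤ-distrib-+ m _ _)
                                   (cong₂ _+_ (sumℤ-*ˡ m λ₀ E) (trans (sumℤ-neg m _) (cong -_ (sumℤ-*ˡ m (+ a) E)))))
                            (sumℤ-*ˡ m (+ suc a) E′)) ⟩
      (λ₀ * ΣE + - (+ a * ΣE)) + + suc a * ΣE′
        ≡⟨ cong₂ (λ u v → (λ₀ * u + - (+ a * u)) + + suc a * v)
                 (alternatingSum′≡δ m b b<m a) (alternatingSum′≡δ m b b<m (suc a)) ⟩
      λ₀ * δ a b - + a * δ a b + + suc a * δ (suc a) b ∎
      where
      open ≡-Reasoning
      E E′ : ℕ → ℤ
      E c = sign (a ℕ.+ c) * (binom c a * binom b c)
      E′ c = sign (suc a ℕ.+ c) * (binom c (suc a) * binom b c)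
      ΣE : ℤ
      ΣE = sumℤ E m
      ΣE′ : ℤ
      ΣE′ = sumℤ E′ m
      expand : ∀ s x L C z → s * x * ((L - C) * z) ≡ L * (s * (x * z)) - (C * x) * (s * z)
      expand = solve-∀
      collect : ∀ L A A′ x y z s → L * (s * (x * z)) - (A * x + A′ * y) * (s * z)
                                   ≡ (L * (s * (x * z)) + - (A * (s * (x * z)))) + A′ * (- s * (y * z))
      collect = solve-∀
      c*binom : ∀ c → + c * binom c a ≡ + a * binom c a + + suc a * binom c (suc a)
      c*binom c = trans (sym (pos-* c (c C a))) (trans (cong +_ (n*nCk≡k*nCk+[k+1]*nC[k+1] c a))
                    (trans (pos-+ (a ℕ.* (c C a)) _) (cong₂ _+_ (pos-* a _) (pos-* (suc a) _))))
      term : ∀ c → sign (a ℕ.+ c) * binom c a * ((λ₀ - + c) * binom b c) ≡ (λ₀ * E c + - (+ a * E c)) + + suc a * E′ c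
      term c = trans (expand (sign (a ℕ.+ c)) (binom c a) λ₀ (+ c) (binom b c))
        (trans (cong (λ z → λ₀ * E c - z * (sign (a ℕ.+ c) * binom b c)) (c*binom c))
          (collect λ₀ (+ a) (+ suc a) (binom c a) (binom c (suc a)) (binom b c) (sign (a ℕ.+ c))))

  bidiagonal-δ : ∀ (λ₀ : ℤ) x y → λ₀ * δ x y - + x * δ x y + + suc x * δ (suc x) y
                                 ≡ (if x ≡ᵇ y then λ₀ - + x else if suc x ≡ᵇ y then + y else + 0)
  bidiagonal-δ λ₀ x y with x ≡ᵇ y in x≡ᵇy | suc x ≡ᵇ y in x+1≡ᵇy
  ... | true  | true  =
    ⊥-elim (ℕₚ.<-irrefl (trans (≡ᵇ-true⇒≡ x y x≡ᵇy) (sym (≡ᵇ-true⇒≡ (suc x) y x+1≡ᵇy))) (ℕₚ.n<1+n x))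
  ... | true  | false = diagonal λ₀ (+ x) (+ suc x)
    where
    diagonal : ∀ L X X′ → L * + 1 - X * + 1 + X′ * + 0 ≡ L - X
    diagonal = solve-∀
  ... | false | true rewrite sym (≡ᵇ-true⇒≡ (suc x) y x+1≡ᵇy) = superdiagonal λ₀ (+ x) (+ suc x)
    where
    superdiagonal : ∀ L X X′ → L * + 0 - X * + 0 + X′ * + 1 ≡ X′
    superdiagonal = solve-∀
  ... | false | false = elsewhere λ₀ (+ x) (+ suc x)
    where
    elsewhere : ∀ L X X′ → L * + 0 - X * + 0 + X′ * + 0 ≡ + 0
    elsewhere = solve-∀

  Mmat≡RΛL : ∀ j₁ J p (a b : Fin (suc (J ∸ j₁))) → Mmat j₁ J p a b ≡ (Rmat ⊗ (Λmat j₁ J p ⊗ Lmat)) a b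
  Mmat≡RΛL j₁ J p a b = sym (begin
    sumFin {m} (λ c → Rmat a c * sumFin {m} (λ d → Λmat j₁ J p c d * Lmat d b))
      ≡⟨ sumFin-cong m (λ c → cong₂ _*_ (Rmat-entry (toℕ a) (toℕ c)) (ΛL-entry c)) ⟩
    sumFin {m} (λ c → sign (toℕ a ℕ.+ toℕ c) * binom (toℕ c) (toℕ a) * ((λ₀ - + toℕ c) * binom (toℕ b) (toℕ c)))
      ≡⟨ sumFin≡sumℤ m (λ c → sign (toℕ a ℕ.+ c) * binom c (toℕ a) * ((λ₀ - + c) * binom (toℕ b) c)) ⟩
    sumℤ (λ c → sign (toℕ a ℕ.+ c) * binom c (toℕ a) * ((λ₀ - + c) * binom (toℕ b) c)) m
      ≡⟨ RΛL-entry m (toℕ b) (toℕ<n b) λ₀ (toℕ a) ⟩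
    λ₀ * δ (toℕ a) (toℕ b) - + toℕ a * δ (toℕ a) (toℕ b) + + suc (toℕ a) * δ (suc (toℕ a)) (toℕ b)
      ≡⟨ bidiagonal-δ λ₀ (toℕ a) (toℕ b) ⟩
    Mmat j₁ J p a b ∎)
    where
    open ≡-Reasoning
    m : ℕ
    m = suc (J ∸ j₁)
    λ₀ : ℤ
    λ₀ = + p - + j₁ - + 1
    ΛL-entry : ∀ c → sumFin {m} (λ d → Λmat j₁ J p c d * Lmat d b) ≡ (λ₀ - + toℕ c) * binom (toℕ b) (toℕ c)
    ΛL-entry c = begin
      sumFin {m} (λ d → Λmat j₁ J p c d * Lmat d b)
        ≡⟨ sumFin-cong m (λ d → cong (Λmat j₁ J p c d *_) (Lmat-entry (toℕ d) (toℕ b))) ⟩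
      sumFin {m} (λ d → Λ (toℕ d) * binom (toℕ b) (toℕ d))
        ≡⟨ sumFin≡sumℤ m (λ d → Λ d * binom (toℕ b) d) ⟩
      sumℤ (λ d → Λ d * binom (toℕ b) d) m
        ≡⟨ sumℤ-single m _ (toℕ c) (toℕ<n c) (λ d d≢c → cong (_* binom (toℕ b) d) (off-diagonal d d≢c)) ⟩
      Λ (toℕ c) * binom (toℕ b) (toℕ c)
        ≡⟨ cong (_* binom (toℕ b) (toℕ c)) (on-diagonal (toℕ c)) ⟩
      (λ₀ - + toℕ c) * binom (toℕ b) (toℕ c) ∎
      where
      Λ : ℕ → ℤ
      Λ d = if toℕ c ≡ᵇ d then diagEntry p j₁ (toℕ c) else + 0
      off-diagonal : ∀ d → d ≢ toℕ c → Λ d ≡ + 0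
      off-diagonal d d≢c rewrite ≢⇒≡ᵇ-false (toℕ c) d (λ e → d≢c (sym e)) = refl
      on-diagonal : ∀ k → (if k ≡ᵇ k then diagEntry p j₁ (toℕ c) else + 0) ≡ diagEntry p j₁ (toℕ c)
      on-diagonal k rewrite ≡⇒≡ᵇ-true k k refl = refl

  module _ (p j₁ : ℕ) where

    bidiagonal : ℕ → ℕ → ℤ
    bidiagonal x y = if x ≡ᵇ y then diagEntry p j₁ x else (if suc x ≡ᵇ y then + y else + 0)

    bidiagonal-off : ∀ x y → y ≢ x → y ≢ suc x → bidiagonal x y ≡ + 0
    bidiagonal-off x y y≢x y≢x+1
      rewrite ≢⇒≡ᵇ-false x y (λ e → y≢x (sym e)) | ≢⇒≡ᵇ-false (suc x) y (λ e → y≢x+1 (sym e)) = refl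

    bidiagonal-diag : ∀ x → bidiagonal x x ≡ diagEntry p j₁ x
    bidiagonal-diag x rewrite ≡⇒≡ᵇ-true x x refl = refl

    bidiagonal-super : ∀ x → bidiagonal x (suc x) ≡ + suc x
    bidiagonal-super x
      rewrite ≢⇒≡ᵇ-false x (suc x) (λ e → ℕₚ.<-irrefl e (ℕₚ.n<1+n x)) | ≡⇒≡ᵇ-true (suc x) (suc x) refl = refl

    sumℤ-bidiagonal : ∀ m (w : ℕ → ℤ) x → x < m → (suc x < m ⊎ w (suc x) ≡ + 0) →
      sumℤ (λ y → bidiagonal x y * w y) m ≡ diagEntry p j₁ x * w x + + suc x * w (suc x)
    sumℤ-bidiagonal m w x x<m (inj₁ x+1<m) =
      trans (sumℤ-pair m _ x x+1<m (λ y y≢x y≢x+1 → cong (_* w y) (bidiagonal-off x y y≢x y≢x+1)))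
            (cong₂ _+_ (cong (_* w x) (bidiagonal-diag x)) (cong (_* w (suc x)) (bidiagonal-super x)))
    sumℤ-bidiagonal m w x x<m (inj₂ w≡0) =
      trans (sumℤ-single m _ x x<m off)
        (trans (cong (_* w x) (bidiagonal-diag x))
          (sym (trans (cong (λ z → diagEntry p j₁ x * w x + + suc x * z) w≡0)
                 (trans (cong (λ z → diagEntry p j₁ x * w x + z) (*-zeroʳ (+ suc x))) (+-identityʳ _)))))
      where
      off : ∀ y → y ≢ x → bidiagonal x y * w y ≡ + 0
      off y y≢x with y ℕₚ.≟ suc x
      ... | yes refl   = trans (cong (bidiagonal x (suc x) *_) w≡0) (*-zeroʳ (bidiagonal x (suc x)))
      ... | no y≢x+1 = cong (_* w y) (bidiagonal-off x y y≢x y≢x+1)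

  isolate-first : ∀ (N′ W W′ P J₁ X X′ : ℤ) → N′ + (+ 1 + (J₁ + X)) * W ≡ P * W + X′ * W′ →
    (P - J₁ - + 1 - X) * W + X′ * W′ ≡ N′
  isolate-first N′ W W′ P J₁ X X′ h =
    trans (regroup P J₁ X W (X′ * W′)) (trans (cong (_- (+ 1 + (J₁ + X)) * W) (sym h)) (cancel N′ _))
    where
    regroup : ∀ P J₁ X W Y → (P - J₁ - + 1 - X) * W + Y ≡ (P * W + Y) - (+ 1 + (J₁ + X)) * W
    regroup = solve-∀
    cancel : ∀ a b → a + b - b ≡ a
    cancel = solve-∀

  -- The vanishing hypothesis disposes of the superdiagonal entry of the last row.
  Mmat-recurrence : ∀ j₁ J p (n n′ : ℕ → ℕ) → (∀ y → J ∸ j₁ < y → n y ≡ 0) →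
    (∀ x → n′ x ℕ.+ suc (j₁ ℕ.+ x) ℕ.* n x ≡ p ℕ.* n x ℕ.+ suc x ℕ.* n (suc x)) →
    ∀ a → + n′ (toℕ a) ≡ (Mmat j₁ J p · (λ b → + n (toℕ b))) a
  Mmat-recurrence j₁ J p n n′ vanish rec a = sym (begin
    sumFin {m} (λ c → bidiagonal p j₁ x (toℕ c) * w (toℕ c))
      ≡⟨ sumFin≡sumℤ m (λ y → bidiagonal p j₁ x y * w y) ⟩
    sumℤ (λ y → bidiagonal p j₁ x y * w y) m
      ≡⟨ sumℤ-bidiagonal p j₁ m w x (toℕ<n a) last-row ⟩
    diagEntry p j₁ x * w x + + suc x * w (suc x)
      ≡⟨ isolate-first (+ n′ x) (w x) (w (suc x)) (+ p) (+ j₁) (+ x) (+ suc x) rec-ℤ ⟩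
    + n′ x ∎)
    where
    open ≡-Reasoning
    m : ℕ
    m = suc (J ∸ j₁)
    x : ℕ
    x = toℕ a
    w : ℕ → ℤ
    w y = + n y
    last-row : suc x < m ⊎ w (suc x) ≡ + 0
    last-row with suc x ℕₚ.<? m
    ... | yes x+1<m = inj₁ x+1<m
    ... | no  x+1≮m = inj₂ (cong +_ (vanish (suc x) (ℕₚ.≮⇒≥ x+1≮m)))
    rec-ℤ : + n′ x + (+ 1 + (+ j₁ + + x)) * w x ≡ + p * w x + + suc x * w (suc x)
    rec-ℤ = begin
      + n′ x + (+ 1 + (+ j₁ + + x)) * w x
        ≡⟨ cong (λ z → + n′ x + z * w x) (sym (trans (pos-+ 1 (j₁ ℕ.+ x)) (cong (λ z → + 1 + z) (pos-+ j₁ x)))) ⟩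
      + n′ x + + suc (j₁ ℕ.+ x) * w x
        ≡⟨ cong (λ z → + n′ x + z) (sym (pos-* (suc (j₁ ℕ.+ x)) (n x))) ⟩
      + n′ x + + (suc (j₁ ℕ.+ x) ℕ.* n x)
        ≡⟨ sym (pos-+ (n′ x) _) ⟩
      + (n′ x ℕ.+ suc (j₁ ℕ.+ x) ℕ.* n x)
        ≡⟨ cong +_ (rec x) ⟩
      + (p ℕ.* n x ℕ.+ suc x ℕ.* n (suc x))
        ≡⟨ trans (pos-+ (p ℕ.* n x) _) (cong₂ _+_ (pos-* p (n x)) (pos-* (suc x) (n (suc x)))) ⟩
      + p * w x + + suc x * w (suc x) ∎

open import Data.Nat using (_+_; _*_; _∸_; _≤_; _<_)
open import Data.Nat.Properties using (<-≤-trans; *-monoʳ-≤; *-zeroʳ; +-identityʳ; +-suc; m+n∸m≡n; m+[n∸m]≡n; +-monoʳ-<; m<n⇒m<1+n)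
open import Data.Nat.ListAction using (sum)
open import Data.Nat.Primality using (Prime)
open import Data.Fin using (Fin; toℕ)
open Primorials using (primeSeq-prime; primeSeq-mono)
open DrivingTerms using (drivingCount-nextPrime)
open BinomialMatrices using (Mmat-recurrence; Mmat≡RΛL; Lmat⊗Rmat≡identity)

module PrimeSequence (s : List ℕ) (pos : All (0 <_) s) (p₀ : ℕ) (pp : Prime p₀) (short : sum s < 2 * primeSeq p₀ 1) where

  N : ℕ → ℕ
  N k = primorial (primeSeq p₀ k)

  drivingCount-primeSeq : ∀ k j → drivingCount s j (N (suc k)) + suc j * drivingCount s j (N k)
    ≡ primeSeq p₀ (suc k) * drivingCount s j (N k) + (suc j ∸ length s) * drivingCount s (suc j) (N k)
  drivingCount-primeSeq k j = drivingCount-nextPrime (primeSeq p₀ k) (primeSeq-prime p₀ pp k) s pos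
    (<-≤-trans short (*-monoʳ-≤ 2 (primeSeq-mono p₀ pp k))) j

  drivingCount-vanishes : ∀ J → (∀ j → J < j → drivingCount s j (N 0) ≡ 0) → ∀ k j → J < j → drivingCount s j (N k) ≡ 0
  drivingCount-vanishes J vanish₀ zero    j J<j = vanish₀ j J<j
  drivingCount-vanishes J vanish₀ (suc k) j J<j = begin
    drivingCount s j (N (suc k))
      ≡⟨ sym (trans (cong (drivingCount s j (N (suc k)) +_) (trans (cong (suc j *_) vanishₖ) (*-zeroʳ (suc j))))
                    (+-identityʳ _)) ⟩
    drivingCount s j (N (suc k)) + suc j * drivingCount s j (N k)
      ≡⟨ drivingCount-primeSeq k j ⟩
    primeSeq p₀ (suc k) * drivingCount s j (N k) + (suc j ∸ length s) * drivingCount s (suc j) (N k)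
      ≡⟨ cong₂ _+_ (trans (cong (primeSeq p₀ (suc k) *_) vanishₖ) (*-zeroʳ (primeSeq p₀ (suc k))))
                   (trans (cong ((suc j ∸ length s) *_) (drivingCount-vanishes J vanish₀ k (suc j) (m<n⇒m<1+n J<j)))
                          (*-zeroʳ (suc j ∸ length s))) ⟩
    0 ∎
    where
    open ≡-Reasoning
    vanishₖ : drivingCount s j (N k) ≡ 0
    vanishₖ = drivingCount-vanishes J vanish₀ k j J<j

  drivingCount-recurrence : ∀ k x → let j₁ = length s in
    drivingCount s (j₁ + x) (N (suc k)) + suc (j₁ + x) * drivingCount s (j₁ + x) (N k)
      ≡ primeSeq p₀ (suc k) * drivingCount s (j₁ + x) (N k) + suc x * drivingCount s (j₁ + suc x) (N k)
  drivingCount-recurrence k x = trans (drivingCount-primeSeq k (length s + x))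
    (cong₂ (λ u v → primeSeq p₀ (suc k) * drivingCount s (length s + x) (N k) + u * drivingCount s v (N k))
           (trans (cong (_∸ length s) (sym (+-suc (length s) x))) (m+n∸m≡n (length s) (suc x)))
           (sym (+-suc (length s) x)))

mainTheorem13 : (s : List ℕ) → All (λ x → 0 < x) s →
    (p₀ : ℕ) → Prime p₀ →
    sum s < 2 * primeSeq p₀ 1 →
    (J : ℕ) → length s ≤ J →
    (∀ j → J < j → drivingCount s j (primorial p₀) ≡ 0) →
    ((k : ℕ) → 1 ≤ k →
       ∀ a → nvec s J (primorial (primeSeq p₀ k)) a
             ≡ (Mmat (length s) J (primeSeq p₀ k) · nvec s J (primorial (primeSeq p₀ (k ∸ 1)))) a)
    × ((p : ℕ) → ∀ a b →
       Mmat (length s) J p a b ≡ (Rmat ⊗ (Λmat (length s) J p ⊗ Lmat)) a b)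
    × (∀ (a b : Fin (suc (J ∸ length s))) → (Lmat ⊗ Rmat) a b ≡ identity a b)
mainTheorem13 s pos p₀ pp short J j₁≤J vanish₀ =
  recursion , (λ p → Mmat≡RΛL (length s) J p) , Lmat⊗Rmat≡identity (suc (J ∸ length s))
  where
  open PrimeSequence s pos p₀ pp short
  recursion : (k : ℕ) → 1 ≤ k → ∀ a → nvec s J (N k) a ≡ (Mmat (length s) J (primeSeq p₀ k) · nvec s J (N (k ∸ 1))) a
  recursion (suc k) _ = Mmat-recurrence (length s) J (primeSeq p₀ (suc k))
    (λ x → drivingCount s (length s + x) (N k)) (λ x → drivingCount s (length s + x) (N (suc k)))
    (λ y J∸j₁<y → drivingCount-vanishes J vanish₀ k (length s + y)
                    (subst (_< length s + y) (m+[n∸m]≡n j₁≤J) (+-monoʳ-< (length s) J∸j₁<y)))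
    (drivingCount-recurrence k)
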